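{- There exist a $5$-dimensional generalized permutahedron $P\subset\mathbb R^6$ and a direction $\mathbf c\in\mathbb R^6$ such that neither the sequence $(N_\ell)_\ell$ of the numbers of $\mathbf c$-monotone paths of length $\ell$ on $P$, nor the sequence $(N^{\mathrm{coh}}_\ell)_\ell$ of the numbers of coherent $\mathbf c$-monotone paths of length $\ell$ on $P$, is unimodal.
   Context: A generalized permutahedron in $\mathbb R^n$ is a polytope each of whose edges is parallel to $e_i-e_j$ for some $1\le i<j\le n$ ($e_i$ the standard basis vectors). For a polytope $P$ and $\mathbf c$ such that $\langle\cdot,\mathbf c\rangle$ attains its minimum and maximum over $P$ at unique vertices $v_{\min}$, $v_{\max}$, let $G_{P,\mathbf c}$ be the directed graph on the vertices of $P$ with an arc $u\to v$ whenever $[u,v]$ is an edge of $P$ with $\langle u,\mathbf c\rangle<\langle v,\mathbf c\rangle$. A $\mathbf c$-monotone path is a directed path in $G_{P,\mathbf c}$ from $v_{\min}$ to $v_{\max}$; its length is its number of edges. Such a path is coherent if there is $\boldsymbol\omega$ linearly independent from $\mathbf c$ such that the path is exactly the set of preimages, under $x\mapsto(\langle x,\mathbf c\rangle,\langle x,\boldsymbol\omega\rangle)$, of the upper faces of the polygon $\{(\langle x,\mathbf c\rangle,\langle x,\boldsymbol\omega\rangle):x\in P\}$ (a vertex or edge is an upper face if it has an outer normal with positive second coordinate). A finite sequence $(a_1,\dots,a_r)$ is unimodal if there is $k$ with $a_i\le a_{i+1}$ for $i<k$ and $a_i\ge a_{i+1}$ for $i\ge k$. -}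

module Defs where

open import Data.Nat using (ℕ; zero; suc)
import Data.Nat as N
open import Data.Fin using (Fin; zero; suc; fromℕ; inject₁; _≟_)
open import Data.Rational using (ℚ; 0ℚ; 1ℚ; _+_; _*_; _-_; _≤_; _<_)
open import Data.Vec using (Vec; []; _∷_; lookup; tabulate; zipWith; map; replicate)
open import Data.List using (List; length)
open import Data.List.Membership.Propositional using (_∈_)
open import Data.List.Relation.Unary.Unique.Propositional using (Unique)
open import Data.Product using (Σ; ∃; ∃-syntax; _×_; _,_)
open import Data.Sum using (_⊎_)
open import Data.Bool using (if_then_else_)
open import Relation.Nullary using (¬_; does)
open import Relation.Binary.PropositionalEquality using (_≡_; _≢_)
open import Function.Bundles using (_⇔_)

Point : Set
Point = Vec ℚ 6

infixl 6 _+v_ _-v_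
infixl 7 _·v_

_+v_ : ∀ {n} → Vec ℚ n → Vec ℚ n → Vec ℚ n
_+v_ = zipWith _+_

_-v_ : ∀ {n} → Vec ℚ n → Vec ℚ n → Vec ℚ n
_-v_ = zipWith _-_

_·v_ : ∀ {n} → ℚ → Vec ℚ n → Vec ℚ n
a ·v v = map (a *_) v

⟨_,_⟩ : ∀ {n} → Vec ℚ n → Vec ℚ n → ℚ
⟨ [] , [] ⟩ = 0ℚ
⟨ x ∷ xs , y ∷ ys ⟩ = x * y + ⟨ xs , ys ⟩

e : Fin 6 → Point
e i = tabulate (λ j → if does (i ≟ j) then 1ℚ else 0ℚ)

qsum : ∀ {k} → (Fin k → ℚ) → ℚ
qsum {zero} f = 0ℚ
qsum {suc k} f = f zero + qsum (λ i → f (suc i))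

vsum : ∀ {k} → (Fin k → Point) → Point
vsum {zero} f = replicate 6 0ℚ
vsum {suc k} f = f zero +v vsum (λ i → f (suc i))

zeroP : Point
zeroP = replicate 6 0ℚ

-- The polytope P = conv(V) for a finite list V of points.

InSegment : Point → Point → Point → Set
InSegment u v x = ∃[ t ] (0ℚ ≤ t × t ≤ 1ℚ × x ≡ (1ℚ - t) ·v u +v t ·v v)

Vertex : List Point → Point → Set
Vertex V v = v ∈ V × ∃[ w ] (∀ x → x ∈ V → x ≢ v → ⟨ w , x ⟩ < ⟨ w , v ⟩)

Edge : List Point → Point → Point → Set
Edge V u v = Vertex V u × Vertex V v × u ≢ v ×
  ∃[ w ] (⟨ w , u ⟩ ≡ ⟨ w , v ⟩ ×
          (∀ x → x ∈ V → ⟨ w , x ⟩ ≤ ⟨ w , u ⟩) ×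
          (∀ x → x ∈ V → ⟨ w , x ⟩ ≡ ⟨ w , u ⟩ → InSegment u v x))

GenPermutahedron : List Point → Set
GenPermutahedron V = ∀ u v → Edge V u v →
  ∃[ i ] ∃[ j ] (i ≢ j × ∃[ λ′ ] (v -v u ≡ λ′ ·v (e i -v e j)))

AffinelyIndependent : ∀ {k} → (Fin k → Point) → Set
AffinelyIndependent {k} p = ∀ (λ′ : Fin k → ℚ) →
  qsum λ′ ≡ 0ℚ → vsum (λ i → λ′ i ·v p i) ≡ zeroP → ∀ i → λ′ i ≡ 0ℚ

HasDimension : List Point → ℕ → Set
HasDimension V d =
  (∃[ p ] ((∀ (i : Fin (suc d)) → p i ∈ V) × AffinelyIndependent p)) ×
  (∀ (p : Fin (suc (suc d)) → Point) → (∀ i → p i ∈ V) → ¬ AffinelyIndependent p)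

IsUniqueMin : List Point → Point → Point → Set
IsUniqueMin V c v = v ∈ V × (∀ x → x ∈ V → x ≢ v → ⟨ c , v ⟩ < ⟨ c , x ⟩)

IsUniqueMax : List Point → Point → Point → Set
IsUniqueMax V c v = v ∈ V × (∀ x → x ∈ V → x ≢ v → ⟨ c , x ⟩ < ⟨ c , v ⟩)

GenericDirection : List Point → Point → Set
GenericDirection V c = (∃[ v ] IsUniqueMin V c v) × (∃[ v ] IsUniqueMax V c v)

MonotonePath : List Point → Point → (ℓ : ℕ) → Vec Point (suc ℓ) → Set
MonotonePath V c ℓ p =
  IsUniqueMin V c (lookup p zero) × IsUniqueMax V c (lookup p (fromℕ ℓ)) ×
  (∀ (i : Fin ℓ) → Edge V (lookup p (inject₁ i)) (lookup p (suc i)) ×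
                   ⟨ c , lookup p (inject₁ i) ⟩ < ⟨ c , lookup p (suc i) ⟩)

LinearlyIndependent₂ : Point → Point → Set
LinearlyIndependent₂ c ω = ∀ α β → α ·v c +v β ·v ω ≡ zeroP → α ≡ 0ℚ × β ≡ 0ℚ

Argmax : List Point → Point → Point → Set
Argmax V f x = x ∈ V × (∀ y → y ∈ V → ⟨ f , y ⟩ ≤ ⟨ f , x ⟩)

-- The preimage in P of the face of the polygon π(P) with outer normal (a,b),
-- π x = (⟨x,c⟩,⟨x,ω⟩), is the face of P maximizing ⟨·, a c + b ω⟩.
PreimageIsVertex : List Point → Point → Point → ℚ → ℚ → Point → Set
PreimageIsVertex V c ω a b v =
  Argmax V (a ·v c +v b ·v ω) v × (∀ x → Argmax V (a ·v c +v b ·v ω) x → x ≡ v)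

PreimageIsSegment : List Point → Point → Point → ℚ → ℚ → Point → Point → Set
PreimageIsSegment V c ω a b u v =
  Argmax V (a ·v c +v b ·v ω) u × Argmax V (a ·v c +v b ·v ω) v ×
  (∀ x → Argmax V (a ·v c +v b ·v ω) x → InSegment u v x)

-- coherent monotone path: for some ω independent of c, the set of preimages of
-- upper faces (outer normal (a,b) with b > 0) is exactly the set of vertices and
-- edges of the path
CoherentMonotonePath : List Point → Point → (ℓ : ℕ) → Vec Point (suc ℓ) → Set
CoherentMonotonePath V c ℓ p = MonotonePath V c ℓ p × ∃[ ω ] (LinearlyIndependent₂ c ω ×
  (∀ a b → 0ℚ < b →
     (∃[ i ] PreimageIsVertex V c ω a b (lookup p i)) ⊎
     (∃[ i ] PreimageIsSegment V c ω a b (lookup p (inject₁ i)) (lookup p (suc i)))) ×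
  (∀ (i : Fin (suc ℓ)) → ∃[ a ] ∃[ b ] (0ℚ < b × PreimageIsVertex V c ω a b (lookup p i))) ×
  (∀ (i : Fin ℓ) → ∃[ a ] ∃[ b ] (0ℚ < b ×
       PreimageIsSegment V c ω a b (lookup p (inject₁ i)) (lookup p (suc i)))))

HasCount : (A : Set) → (A → Set) → ℕ → Set
HasCount A P n = ∃[ xs ] (length xs ≡ n × Unique xs × (∀ (x : A) → (x ∈ xs ⇔ P x)))

Unimodal : (ℕ → ℕ) → Set
Unimodal a = ∃[ k ] ((∀ i → i N.< k → a i N.≤ a (suc i)) × (∀ i → k N.≤ i → a (suc i) N.≤ a i))

-- The example is the convex hull of 2e₃, e₃ + eₖ, e₀ + eₖ and 2e₀ (k = 1, 2, 4, 5),
-- a five-dimensional generalized permutahedron on the hyperplane Σ xᵢ = 2, with the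
-- generic direction c = (11, 2, 10, 0, 8, 3).  Its vertices and the 25 edges going up
-- in direction c are certified by exposing functionals, and every other pair of
-- vertices by a linear relation forbidding an edge.  The c-monotone paths are then
-- the walks from 2e₃ to 2e₀ in this graph; their numbers by length are
-- 0, 1, 0, 4, 12, 12, 4, 0, 0, …, which fall and then rise at length 2.
--
-- Each of these paths is coherent.  If a monotone path is mapped by π = (⟨·,c⟩ , ⟨·,ω⟩)
-- to a strictly concave chain lying above the images of all other vertices, then a
-- linear form with positive second coordinate, restricted to the chain, rises and
-- then falls, so its maximum over the polytope is attained at a vertex or an edge of
-- the path; the edges of the path are exposed by the normals of the chain, and its
-- vertices by sums of two consecutive normals.  So both counting sequences are the
-- one above.

module Submission where

open import Defs
import Agda.Builtin.FromNat as FromNat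
import Agda.Builtin.FromNeg as FromNeg
open import Data.Nat as ℕ using (ℕ; zero; suc)
import Data.Nat.Properties as ℕₚ
import Data.Nat.Literals as ℕ-Literals
open import Data.Rational
  using (ℚ; 0ℚ; 1ℚ; _+_; _*_; _-_; -_; _≤_; _<_; _≤?_; _<?_; positive; negative; nonNegative; nonPositive; ≢-nonZero; 1/_)
open import Data.Rational.Properties
open import Data.Rational.Solver using (module +-*-Solver)
import Data.Rational.Literals as ℚ-Literals
open import Data.Fin as Fin using (Fin; zero; suc; inject₁; fromℕ)
import Data.Fin.Properties as Finₚ
import Data.Fin.Literals as Fin-Literals
open import Data.Vec as Vec using (Vec; []; _∷_; lookup)
import Data.Vec.Properties as Vecₚ
open import Data.Vec.Functional using (insertAt)
import Data.Vec.Functional.Properties as VecFₚ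
open import Data.List as List using (List; []; _∷_)
import Data.List.Properties as Listₚ
open import Data.List.Membership.Propositional using (_∈_)
open import Data.List.Membership.Propositional.Properties using (∈-map⁺; ∈-map⁻; ∈-allFin; ∈-concat⁺′; ∈-concat⁻′)
import Data.List.Membership.DecPropositional as DecMembership
open import Data.List.Relation.Unary.All as All using (All; []; _∷_)
open import Data.List.Relation.Unary.Any using (here; there)
open import Data.List.Relation.Unary.AllPairs using (allPairs?; [])
open import Data.List.Relation.Unary.Unique.Propositional using (Unique)
import Data.List.Relation.Unary.Unique.Propositional.Properties as Uniqueₚ
open import Data.Product using (∃-syntax; Σ-syntax; _×_; _,_; proj₁; proj₂)
import Data.Product.Properties as Productₚ
open import Data.Sum using (_⊎_; inj₁; inj₂; map₂)
open import Data.Empty using (⊥-elim)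
open import Data.Unit using (⊤; tt)
open import Function using (_∘_)
open import Function.Bundles using (mk⇔)
open import Relation.Binary.PropositionalEquality
open import Relation.Binary.Definitions using (tri<; tri≈; tri>)
open import Relation.Nullary using (¬_; yes; no; Dec; ¬?)
open import Relation.Nullary.Decidable using (_×-dec_; _⊎-dec_; _→-dec_; decidable-stable; map′; from-yes)

open +-*-Solver using (solve; _:+_; _:*_; _:-_; :-_; _:=_; con)

-- Vectors over ℚ

⟨⟩-+ʳ : ∀ {n} (w x y : Vec ℚ n) → ⟨ w , x +v y ⟩ ≡ ⟨ w , x ⟩ + ⟨ w , y ⟩
⟨⟩-+ʳ [] [] [] = refl
⟨⟩-+ʳ (w ∷ ws) (x ∷ xs) (y ∷ ys) rewrite ⟨⟩-+ʳ ws xs ys =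
  solve 5 (λ w x y s t → w :* (x :+ y) :+ (s :+ t) := (w :* x :+ s) :+ (w :* y :+ t))
    refl w x y ⟨ ws , xs ⟩ ⟨ ws , ys ⟩

⟨⟩-·ʳ : ∀ {n} (w : Vec ℚ n) a x → ⟨ w , a ·v x ⟩ ≡ a * ⟨ w , x ⟩
⟨⟩-·ʳ [] a [] = sym (*-zeroʳ a)
⟨⟩-·ʳ (w ∷ ws) a (x ∷ xs) rewrite ⟨⟩-·ʳ ws a xs =
  solve 4 (λ w a x s → w :* (a :* x) :+ a :* s := a :* (w :* x :+ s)) refl w a x ⟨ ws , xs ⟩

⟨⟩-+ˡ : ∀ {n} (x y w : Vec ℚ n) → ⟨ x +v y , w ⟩ ≡ ⟨ x , w ⟩ + ⟨ y , w ⟩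
⟨⟩-+ˡ [] [] [] = refl
⟨⟩-+ˡ (x ∷ xs) (y ∷ ys) (w ∷ ws) rewrite ⟨⟩-+ˡ xs ys ws =
  solve 5 (λ w x y s t → (x :+ y) :* w :+ (s :+ t) := (x :* w :+ s) :+ (y :* w :+ t))
    refl w x y ⟨ xs , ws ⟩ ⟨ ys , ws ⟩

⟨⟩-·ˡ : ∀ {n} a (x w : Vec ℚ n) → ⟨ a ·v x , w ⟩ ≡ a * ⟨ x , w ⟩
⟨⟩-·ˡ a [] [] = sym (*-zeroʳ a)
⟨⟩-·ˡ a (x ∷ xs) (w ∷ ws) rewrite ⟨⟩-·ˡ a xs ws =
  solve 4 (λ w a x s → (a :* x) :* w :+ a :* s := a :* (x :* w :+ s)) refl w a x ⟨ xs , ws ⟩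

⟨⟩-combinationˡ : ∀ {n} a b (c ω x : Vec ℚ n) → ⟨ a ·v c +v b ·v ω , x ⟩ ≡ a * ⟨ c , x ⟩ + b * ⟨ ω , x ⟩
⟨⟩-combinationˡ a b c ω x rewrite ⟨⟩-+ˡ (a ·v c) (b ·v ω) x | ⟨⟩-·ˡ a c x | ⟨⟩-·ˡ b ω x = refl

⟨⟩-combinationʳ : ∀ {n} (w : Vec ℚ n) a b x y → ⟨ w , a ·v x +v b ·v y ⟩ ≡ a * ⟨ w , x ⟩ + b * ⟨ w , y ⟩
⟨⟩-combinationʳ w a b x y rewrite ⟨⟩-+ʳ w (a ·v x) (b ·v y) | ⟨⟩-·ʳ w a x | ⟨⟩-·ʳ w b y = refl

lookup-combination : ∀ {n} a b (x y : Vec ℚ n) i → lookup (a ·v x +v b ·v y) i ≡ a * lookup x i + b * lookup y i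
lookup-combination a b x y i rewrite Vecₚ.lookup-zipWith _+_ i (a ·v x) (b ·v y)
  | Vecₚ.lookup-map i (a *_) x | Vecₚ.lookup-map i (b *_) y = refl

infix 4 _≟ᵥ_

_≟ᵥ_ : ∀ {n} (x y : Vec ℚ n) → Dec (x ≡ y)
_≟ᵥ_ = Vecₚ.≡-dec _≟_

≗⇒≡ : ∀ {n} {x y : Vec ℚ n} → (∀ i → lookup x i ≡ lookup y i) → x ≡ y
≗⇒≡ {x = x} {y} h = trans (sym (Vecₚ.tabulate∘lookup x)) (trans (Vecₚ.tabulate-cong h) (Vecₚ.tabulate∘lookup y))

segment-start : ∀ {n} (u v : Vec ℚ n) → (1ℚ - 0ℚ) ·v u +v 0ℚ ·v v ≡ u
segment-start [] [] = refl
segment-start (u ∷ us) (v ∷ vs) = cong₂ _∷_ (solve 2 (λ u v → (con 1ℚ :- con 0ℚ) :* u :+ con 0ℚ :* v := u) refl u v) (segment-start us vs)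

segment-end : ∀ {n} (u v : Vec ℚ n) → (1ℚ - 1ℚ) ·v u +v 1ℚ ·v v ≡ v
segment-end [] [] = refl
segment-end (u ∷ us) (v ∷ vs) = cong₂ _∷_ (solve 2 (λ u v → (con 1ℚ :- con 1ℚ) :* u :+ con 1ℚ :* v := v) refl u v) (segment-end us vs)

segment-flip : ∀ {n} t (u v : Vec ℚ n) → (1ℚ - t) ·v u +v t ·v v ≡ (1ℚ - (1ℚ - t)) ·v v +v (1ℚ - t) ·v u
segment-flip t [] [] = refl
segment-flip t (u ∷ us) (v ∷ vs) =
  cong₂ _∷_ (solve 3 (λ t u v → (con 1ℚ :- t) :* u :+ t :* v := (con 1ℚ :- (con 1ℚ :- t)) :* v :+ (con 1ℚ :- t) :* u) refl t u v)
    (segment-flip t us vs)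

map-injective : ∀ {A B : Set} {f : A → B} → (∀ {x y} → f x ≡ f y → x ≡ y) →
  ∀ {n} {xs ys : Vec A n} → Vec.map f xs ≡ Vec.map f ys → xs ≡ ys
map-injective f-injective {xs = []} {[]} _ = refl
map-injective f-injective {xs = x ∷ xs} {y ∷ ys} eq =
  cong₂ _∷_ (f-injective (Vecₚ.∷-injectiveˡ eq)) (map-injective f-injective (Vecₚ.∷-injectiveʳ eq))

-- Ordered-field arithmetic

0≤1 : 0ℚ ≤ 1ℚ
0≤1 = nonNegative⁻¹ 1ℚ

<⇒≱ : ∀ {p q} → p < q → ¬ (q ≤ p)
<⇒≱ p<q q≤p = <-irrefl refl (<-≤-trans p<q q≤p)

p<q⇒0<q-p : ∀ {p q} → p < q → 0ℚ < q - p
p<q⇒0<q-p {p} {q} p<q = subst (_< q - p) (+-inverseʳ p) (+-monoˡ-< (- p) p<q)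

p≤q⇒0≤q-p : ∀ {p q} → p ≤ q → 0ℚ ≤ q - p
p≤q⇒0≤q-p {p} {q} p≤q = subst (_≤ q - p) (+-inverseʳ p) (+-monoˡ-≤ (- p) p≤q)

p≤q⇒p-q≤0 : ∀ {p q} → p ≤ q → p - q ≤ 0ℚ
p≤q⇒p-q≤0 {p} {q} p≤q = subst (p - q ≤_) (+-inverseʳ q) (+-monoˡ-≤ (- q) p≤q)

p-q+q≡p : ∀ p q → p - q + q ≡ p
p-q+q≡p = solve 2 (λ p q → p :- q :+ q := p) refl

p-q<0⇒p<q : ∀ {p q} → p - q < 0ℚ → p < q
p-q<0⇒p<q {p} {q} h = subst₂ _<_ (p-q+q≡p p q) (+-identityˡ q) (+-monoˡ-< q h)

p-q≤0⇒p≤q : ∀ {p q} → p - q ≤ 0ℚ → p ≤ q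
p-q≤0⇒p≤q {p} {q} h = subst₂ _≤_ (p-q+q≡p p q) (+-identityˡ q) (+-monoˡ-≤ q h)

0≤p⇒1-p≤1 : ∀ {p} → 0ℚ ≤ p → 1ℚ - p ≤ 1ℚ
0≤p⇒1-p≤1 0≤p = +-monoʳ-≤ 1ℚ (neg-antimono-≤ 0≤p)

*-cancelˡ-<0 : ∀ {d t} → 0ℚ < d → d * t < 0ℚ → t < 0ℚ
*-cancelˡ-<0 {d} {t} 0<d dt<0 =
  *-cancelˡ-<-nonNeg d {{nonNegative (<⇒≤ 0<d)}} (subst (d * t <_) (sym (*-zeroʳ d)) dt<0)

*-cancelˡ-≤0 : ∀ {d t} → 0ℚ < d → d * t ≤ 0ℚ → t ≤ 0ℚ
*-cancelˡ-≤0 {d} {t} 0<d dt≤0 =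
  *-cancelˡ-≤-pos d {{positive 0<d}} (subst (d * t ≤_) (sym (*-zeroʳ d)) dt≤0)

nonNeg*nonPos≤0 : ∀ {p q} → 0ℚ ≤ p → q ≤ 0ℚ → p * q ≤ 0ℚ
nonNeg*nonPos≤0 {p} {q} 0≤p q≤0 =
  nonPositive⁻¹ (p * q) {{nonNeg*nonPos⇒nonPos p {{nonNegative 0≤p}} q {{nonPositive q≤0}}}}

pos*neg<0 : ∀ {p q} → 0ℚ < p → q < 0ℚ → p * q < 0ℚ
pos*neg<0 {p} {q} 0<p q<0 = negative⁻¹ (p * q) {{pos*neg⇒neg p {{positive 0<p}} q {{negative q<0}}}}

nonPos+neg<0 : ∀ {p q} → p ≤ 0ℚ → q < 0ℚ → p + q < 0ℚ
nonPos+neg<0 = +-mono-≤-<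

*-cancelʳ-≡0 : ∀ p q → q ≢ 0ℚ → p * q ≡ 0ℚ → p ≡ 0ℚ
*-cancelʳ-≡0 p q q≢0 pq≡0 = begin
  p              ≡⟨ sym (*-identityʳ p) ⟩
  p * 1ℚ         ≡⟨ cong (p *_) (sym (*-inverseʳ q)) ⟩
  p * (q * 1/ q) ≡⟨ sym (*-assoc p q (1/ q)) ⟩
  p * q * 1/ q   ≡⟨ cong (_* 1/ q) pq≡0 ⟩
  0ℚ * 1/ q      ≡⟨ *-zeroˡ (1/ q) ⟩
  0ℚ             ∎
  where
  open ≡-Reasoning
  instance _ = ≢-nonZero q≢0

independent-of-minor : ∀ (c ω : Point) i j → lookup c i * lookup ω j - lookup c j * lookup ω i ≢ 0ℚ →
  LinearlyIndependent₂ c ω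
independent-of-minor c ω i j minor≢0 α β combination≡0 =
  *-cancelʳ-≡0 α minor minor≢0 (eliminate (lookup ω j) (lookup ω i) α (solve 6 (λ α β ci cj wi wj →
      α :* (ci :* wj :- cj :* wi) := wj :* (α :* ci :+ β :* wi) :- wi :* (α :* cj :+ β :* wj)) refl α β ci cj wi wj)) ,
  *-cancelʳ-≡0 β minor minor≢0 (eliminate (- lookup c j) (- lookup c i) β (solve 6 (λ α β ci cj wi wj →
      β :* (ci :* wj :- cj :* wi) := (:- cj) :* (α :* ci :+ β :* wi) :- (:- ci) :* (α :* cj :+ β :* wj)) refl α β ci cj wi wj))
  where
  ci = lookup c i
  cj = lookup c j
  wi = lookup ω i
  wj = lookup ω j
  minor = ci * wj - cj * wi
  row : ∀ k → α * lookup c k + β * lookup ω k ≡ 0ℚ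
  row k = trans (sym (lookup-combination α β c ω k))
    (trans (cong (λ v → lookup v k) combination≡0) (Vecₚ.lookup-replicate k 0ℚ))
  eliminate : ∀ s t γ → γ * minor ≡ s * (α * ci + β * wi) - t * (α * cj + β * wj) → γ * minor ≡ 0ℚ
  eliminate s t γ expand = begin
    γ * minor                                     ≡⟨ expand ⟩
    s * (α * ci + β * wi) - t * (α * cj + β * wj) ≡⟨ cong₂ (λ x y → s * x - t * y) (row i) (row j) ⟩
    s * 0ℚ - t * 0ℚ                               ≡⟨ solve 2 (λ s t → s :* con 0ℚ :- t :* con 0ℚ := con 0ℚ) refl s t ⟩
    0ℚ                                            ∎
    where open ≡-Reasoning

-- Concave chains in the plane

-- With F = a · first + b · second coordinate, (B - A)(F D - F B) is
-- (D - B)(F B - F A) plus b times the turn at (B , Y).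
concave-step : ∀ a b A B D X Y Z → 0ℚ < b → A < B → B < D →
  (B - A) * (Z - Y) - (D - B) * (Y - X) < 0ℚ →
  a * B + b * Y ≤ a * A + b * X → a * D + b * Z < a * B + b * Y
concave-step a b A B D X Y Z 0<b A<B B<D turn<0 FB≤FA =
  p-q<0⇒p<q (*-cancelˡ-<0 (p<q⇒0<q-p A<B) (subst (_< 0ℚ) (sym identity)
    (nonPos+neg<0 (nonNeg*nonPos≤0 (<⇒≤ (p<q⇒0<q-p B<D)) (p≤q⇒p-q≤0 FB≤FA)) (pos*neg<0 0<b turn<0))))
  where
  identity : (B - A) * ((a * D + b * Z) - (a * B + b * Y))
           ≡ (D - B) * ((a * B + b * Y) - (a * A + b * X)) + b * ((B - A) * (Z - Y) - (D - B) * (Y - X))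
  identity = solve 8 (λ a b A B D X Y Z →
      (B :- A) :* ((a :* D :+ b :* Z) :- (a :* B :+ b :* Y))
    := (D :- B) :* ((a :* B :+ b :* Y) :- (a :* A :+ b :* X)) :+ b :* ((B :- A) :* (Z :- Y) :- (D :- B) :* (Y :- X)))
    refl a b A B D X Y Z

-- Likewise (B - A)(F X - F A) and (B - A)(F X - F B) are multiples of F B - F A, of
-- opposite signs, plus b times the turn; one of them is therefore negative.
below-chord : ∀ a b A B X WA WB WX → 0ℚ < b → A < B → A ≤ X → X ≤ B →
  (B - A) * (WX - WB) - (X - B) * (WB - WA) < 0ℚ →
  (a * X + b * WX < a * A + b * WA) ⊎ (a * X + b * WX < a * B + b * WB)
below-chord a b A B X WA WB WX 0<b A<B A≤X X≤B turn<0 with (a * B + b * WB) ≤? (a * A + b * WA)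
... | yes FB≤FA = inj₁ (p-q<0⇒p<q (*-cancelˡ-<0 (p<q⇒0<q-p A<B) (subst (_< 0ℚ) (sym identity)
      (nonPos+neg<0 (nonNeg*nonPos≤0 (p≤q⇒0≤q-p A≤X) (p≤q⇒p-q≤0 FB≤FA)) (pos*neg<0 0<b turn<0)))))
  where
  identity : (B - A) * ((a * X + b * WX) - (a * A + b * WA))
           ≡ (X - A) * ((a * B + b * WB) - (a * A + b * WA)) + b * ((B - A) * (WX - WB) - (X - B) * (WB - WA))
  identity = solve 8 (λ a b A B X WA WB WX →
      (B :- A) :* ((a :* X :+ b :* WX) :- (a :* A :+ b :* WA))
    := (X :- A) :* ((a :* B :+ b :* WB) :- (a :* A :+ b :* WA)) :+ b :* ((B :- A) :* (WX :- WB) :- (X :- B) :* (WB :- WA)))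
    refl a b A B X WA WB WX
... | no FB≰FA = inj₂ (p-q<0⇒p<q (*-cancelˡ-<0 (p<q⇒0<q-p A<B) (subst (_< 0ℚ) (sym identity)
      (nonPos+neg<0 (nonNeg*nonPos≤0 (p≤q⇒0≤q-p X≤B) (p≤q⇒p-q≤0 (<⇒≤ (≰⇒> FB≰FA)))) (pos*neg<0 0<b turn<0)))))
  where
  identity : (B - A) * ((a * X + b * WX) - (a * B + b * WB))
           ≡ (B - X) * ((a * A + b * WA) - (a * B + b * WB)) + b * ((B - A) * (WX - WB) - (X - B) * (WB - WA))
  identity = solve 8 (λ a b A B X WA WB WX →
      (B :- A) :* ((a :* X :+ b :* WX) :- (a :* B :+ b :* WB))
    := (B :- X) :* ((a :* A :+ b :* WA) :- (a :* B :+ b :* WB)) :+ b :* ((B :- A) :* (WX :- WB) :- (X :- B) :* (WB :- WA)))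
    refl a b A B X WA WB WX

-- Sequences with a single peak

Peaked : ∀ {n} → Vec ℚ n → Set
Peaked (x ∷ y ∷ z ∷ r) = (y ≤ x → z < y) × Peaked (y ∷ z ∷ r)
Peaked _ = ⊤

ApexAt : ∀ {n} → Vec ℚ n → Fin n → Set
ApexAt xs k = ∀ j → j ≢ k → lookup xs j < lookup xs k

PlateauAt : ∀ {n} → Vec ℚ (suc n) → Fin n → Set
PlateauAt xs k = lookup xs (inject₁ k) ≡ lookup xs (suc k) ×
  (∀ j → j ≢ inject₁ k → j ≢ suc k → lookup xs j < lookup xs (inject₁ k))

peaked-tail : ∀ {n} x (xs : Vec ℚ n) → Peaked (x ∷ xs) → Peaked xs
peaked-tail x [] _ = tt
peaked-tail x (y ∷ []) _ = tt
peaked-tail x (y ∷ z ∷ r) (_ , peaked) = peaked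

peaked-descent : ∀ {n} x y (r : Vec ℚ n) → Peaked (x ∷ y ∷ r) → y ≤ x → ∀ j → lookup r j < y
peaked-descent x y (z ∷ r) (z<y , peaked) y≤x zero = z<y y≤x
peaked-descent x y (z ∷ r) (z<y , peaked) y≤x (suc j) =
  <-trans (peaked-descent y z r peaked (<⇒≤ (z<y y≤x)) j) (z<y y≤x)

apex-≤ : ∀ {n} (xs : Vec ℚ n) k → ApexAt xs k → ∀ j → lookup xs j ≤ lookup xs k
apex-≤ xs k apex j with j Fin.≟ k
... | yes refl = ≤-refl
... | no j≢k = <⇒≤ (apex j j≢k)

plateau-≤ : ∀ {n} (xs : Vec ℚ (suc n)) k → PlateauAt xs k → ∀ j → lookup xs j ≤ lookup xs (inject₁ k)
plateau-≤ xs k (flat , below) j with j Fin.≟ inject₁ k | j Fin.≟ suc k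
... | yes refl | _ = ≤-refl
... | no _ | yes refl = ≤-reflexive (sym flat)
... | no j≢k | no j≢k+1 = <⇒≤ (below j j≢k j≢k+1)

peaked-max : ∀ {ℓ} (xs : Vec ℚ (suc ℓ)) → Peaked xs → (∃[ k ] ApexAt xs k) ⊎ (∃[ k ] PlateauAt xs k)
peaked-max (x ∷ []) _ = inj₁ (zero , λ { zero 0≢0 → ⊥-elim (0≢0 refl) })
peaked-max (x ∷ y ∷ r) peaked with <-cmp x y
... | tri> _ _ y<x = inj₁ (zero , apex)
  where
  apex : ApexAt (x ∷ y ∷ r) zero
  apex zero 0≢0 = ⊥-elim (0≢0 refl)
  apex (suc zero) _ = y<x
  apex (suc (suc j)) _ = <-trans (peaked-descent x y r peaked (<⇒≤ y<x) j) y<x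
... | tri≈ _ refl _ = inj₂ (zero , refl , below)
  where
  below : ∀ j → j ≢ zero → j ≢ suc zero → lookup (x ∷ y ∷ r) j < x
  below zero 0≢0 _ = ⊥-elim (0≢0 refl)
  below (suc zero) _ 1≢1 = ⊥-elim (1≢1 refl)
  below (suc (suc j)) _ _ = peaked-descent x y r peaked ≤-refl j
... | tri< x<y _ _ with peaked-max (y ∷ r) (peaked-tail x (y ∷ r) peaked)
...   | inj₁ (k , apex) = inj₁ (suc k , apex′)
  where
  apex′ : ApexAt (x ∷ y ∷ r) (suc k)
  apex′ zero _ = <-≤-trans x<y (apex-≤ (y ∷ r) k apex zero)
  apex′ (suc j) j≢k = apex j (j≢k ∘ cong suc)
...   | inj₂ (k , flat , below) = inj₂ (suc k , flat , below′)
  where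
  below′ : ∀ j → j ≢ inject₁ (suc k) → j ≢ suc (suc k) → lookup (x ∷ y ∷ r) j < lookup (x ∷ y ∷ r) (inject₁ (suc k))
  below′ zero _ _ = <-≤-trans x<y (plateau-≤ (y ∷ r) k (flat , below) zero)
  below′ (suc j) j≢k j≢k+1 = below j (j≢k ∘ cong suc) (j≢k+1 ∘ cong suc)

valley⇒¬unimodal : ∀ (a : ℕ → ℕ) i → a (suc i) ℕ.< a i → a (suc i) ℕ.< a (suc (suc i)) → ¬ Unimodal a
valley⇒¬unimodal a i descent ascent (k , increasing , decreasing) with i ℕ.<? k
... | yes i<k = ℕₚ.<⇒≱ descent (increasing i i<k)
... | no i≮k = ℕₚ.<⇒≱ ascent (decreasing (suc i) (ℕₚ.≤-trans (ℕₚ.≮⇒≥ i≮k) (ℕₚ.n≤1+n i)))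

-- Faces of the convex hull of a finite set

-- Data.Fin.Properties.all? is far slower to normalise, which matters for the
-- checks by evaluation below.
all-Fin? : ∀ {n p} {P : Fin n → Set p} → (∀ i → Dec (P i)) → Dec (∀ i → P i)
all-Fin? {n} P? = map′ (λ all i → All.lookup all (∈-allFin i)) (λ ∀P → All.tabulate (λ {i} _ → ∀P i)) (All.all? P? (List.allFin n))

inSegment-start : ∀ (u v : Point) → InSegment u v u
inSegment-start u v = 0ℚ , ≤-refl , 0≤1 , sym (segment-start u v)

inSegment-end : ∀ (u v : Point) → InSegment u v v
inSegment-end u v = 1ℚ , 0≤1 , ≤-refl , sym (segment-end u v)

inSegment-sym : ∀ {u v x : Point} → InSegment u v x → InSegment v u x
inSegment-sym {u} {v} (t , 0≤t , t≤1 , refl) =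
  1ℚ - t , p≤q⇒0≤q-p t≤1 , 0≤p⇒1-p≤1 0≤t , segment-flip t u v

inSegment-level : ∀ {u v x : Point} g → InSegment u v x → ⟨ g , u ⟩ ≡ ⟨ g , v ⟩ → ⟨ g , x ⟩ ≡ ⟨ g , u ⟩
inSegment-level {u} {v} g (t , _ , _ , refl) gu≡gv rewrite ⟨⟩-combinationʳ g (1ℚ - t) t u v | sym gu≡gv =
  solve 2 (λ t G → (con 1ℚ :- t) :* G :+ t :* G := G) refl t ⟨ g , u ⟩

module Certificates (V : List Point) where

  Maximises : Point → Point → Set
  Maximises w v = All (λ x → x ≡ v ⊎ ⟨ w , x ⟩ < ⟨ w , v ⟩) V

  Minimises : Point → Point → Set
  Minimises w v = All (λ x → x ≡ v ⊎ ⟨ w , v ⟩ < ⟨ w , x ⟩) V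

  MaximisesOnSegment : Point → Point → Point → Set
  MaximisesOnSegment w u v = ⟨ w , u ⟩ ≡ ⟨ w , v ⟩ × All (λ x → x ≡ u ⊎ x ≡ v ⊎ ⟨ w , x ⟩ < ⟨ w , u ⟩) V

  maximises? : ∀ w v → Dec (Maximises w v)
  maximises? w v = All.all? (λ x → (x ≟ᵥ v) ⊎-dec (⟨ w , x ⟩ <? ⟨ w , v ⟩)) V

  maximisesOnSegment? : ∀ w u v → Dec (MaximisesOnSegment w u v)
  maximisesOnSegment? w u v = (⟨ w , u ⟩ ≟ ⟨ w , v ⟩) ×-dec
    All.all? (λ x → (x ≟ᵥ u) ⊎-dec (x ≟ᵥ v) ⊎-dec (⟨ w , x ⟩ <? ⟨ w , u ⟩)) V

  minimises? : ∀ w v → Dec (Minimises w v)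
  minimises? w v = All.all? (λ x → (x ≟ᵥ v) ⊎-dec (⟨ w , v ⟩ <? ⟨ w , x ⟩)) V

  maximises-< : ∀ w {v x} → Maximises w v → x ∈ V → x ≢ v → ⟨ w , x ⟩ < ⟨ w , v ⟩
  maximises-< w max x∈V x≢v with All.lookup max x∈V
  ... | inj₁ x≡v = ⊥-elim (x≢v x≡v)
  ... | inj₂ wx<wv = wx<wv

  maximises-≤ : ∀ w {v x} → Maximises w v → x ∈ V → ⟨ w , x ⟩ ≤ ⟨ w , v ⟩
  maximises-≤ w max x∈V with All.lookup max x∈V
  ... | inj₁ refl = ≤-refl
  ... | inj₂ wx<wv = <⇒≤ wx<wv

  maximises⇒argmax : ∀ {w v} → v ∈ V → Maximises w v → Argmax V w v
  maximises⇒argmax {w} v∈V max = v∈V , λ _ → maximises-≤ w max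

  argmax-maximised : ∀ {w v x} → v ∈ V → Maximises w v → Argmax V w x → x ≡ v
  argmax-maximised {w} {v} {x} v∈V max (x∈V , bound) with x ≟ᵥ v
  ... | yes x≡v = x≡v
  ... | no x≢v = ⊥-elim (<⇒≱ (maximises-< w max x∈V x≢v) (bound _ v∈V))

  onSegment-≤ : ∀ w {u v x} → MaximisesOnSegment w u v → x ∈ V → ⟨ w , x ⟩ ≤ ⟨ w , u ⟩
  onSegment-≤ w (wu≡wv , max) x∈V with All.lookup max x∈V
  ... | inj₁ refl = ≤-refl
  ... | inj₂ (inj₁ refl) = ≤-reflexive (sym wu≡wv)
  ... | inj₂ (inj₂ wx<wu) = <⇒≤ wx<wu

  onSegment⇒argmax-start : ∀ {w u v} → u ∈ V → MaximisesOnSegment w u v → Argmax V w u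
  onSegment⇒argmax-start {w} u∈V max = u∈V , λ _ → onSegment-≤ w max

  onSegment⇒argmax-end : ∀ {w u v} → v ∈ V → MaximisesOnSegment w u v → Argmax V w v
  onSegment⇒argmax-end {w} v∈V max@(wu≡wv , _) = v∈V , λ y y∈V → subst (⟨ w , y ⟩ ≤_) wu≡wv (onSegment-≤ w max y∈V)

  onSegment-argmax : ∀ w {u v x} → u ∈ V → MaximisesOnSegment w u v → Argmax V w x → InSegment u v x
  onSegment-argmax w {u} {v} u∈V (wu≡wv , max) (x∈V , bound) with All.lookup max x∈V
  ... | inj₁ refl = inSegment-start u v
  ... | inj₂ (inj₁ refl) = inSegment-end u v
  ... | inj₂ (inj₂ wx<wu) = ⊥-elim (<⇒≱ wx<wu (bound _ u∈V))

  edge-end∈V : ∀ {u v} → Edge V u v → v ∈ V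
  edge-end∈V (_ , (v∈V , _) , _) = v∈V

  vertex : ∀ {v} w → v ∈ V → Maximises w v → Vertex V v
  vertex w v∈V max = v∈V , w , λ _ → maximises-< w max

  edge : ∀ {u v} w → Vertex V u → Vertex V v → u ≢ v → MaximisesOnSegment w u v → Edge V u v
  edge w vertex-u@(u∈V , _) vertex-v u≢v max@(wu≡wv , _) =
    vertex-u , vertex-v , u≢v , w , wu≡wv , (λ _ → onSegment-≤ w max) ,
    λ x x∈V wx≡wu → onSegment-argmax w u∈V max (x∈V , λ y y∈V → subst (⟨ w , y ⟩ ≤_) (sym wx≡wu) (onSegment-≤ w max y∈V))

  uniqueMax : ∀ c {v} → v ∈ V → Maximises c v → IsUniqueMax V c v
  uniqueMax c v∈V max = v∈V , λ _ → maximises-< c max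

  uniqueMin : ∀ c {v} → v ∈ V → Minimises c v → IsUniqueMin V c v
  uniqueMin c {v} v∈V min = v∈V , λ x x∈V x≢v → lower (All.lookup min x∈V) x≢v
    where
    lower : ∀ {x} → x ≡ v ⊎ ⟨ c , v ⟩ < ⟨ c , x ⟩ → x ≢ v → ⟨ c , v ⟩ < ⟨ c , x ⟩
    lower (inj₁ x≡v) x≢v = ⊥-elim (x≢v x≡v)
    lower (inj₂ cv<cx) _ = cv<cx

  uniqueMin-unique : ∀ {c u v} → IsUniqueMin V c u → IsUniqueMin V c v → v ≡ u
  uniqueMin-unique {u = u} {v} (u∈V , u-min) (v∈V , v-min) with v ≟ᵥ u
  ... | yes v≡u = v≡u
  ... | no v≢u = ⊥-elim (<-asym (u-min v v∈V v≢u) (v-min u u∈V (v≢u ∘ sym)))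

  uniqueMax-unique : ∀ {c u v} → IsUniqueMax V c u → IsUniqueMax V c v → v ≡ u
  uniqueMax-unique {u = u} {v} (u∈V , u-max) (v∈V , v-max) with v ≟ᵥ u
  ... | yes v≡u = v≡u
  ... | no v≢u = ⊥-elim (<-asym (u-max v v∈V v≢u) (v-max u u∈V (v≢u ∘ sym)))

  edge-sym : ∀ {u v} → Edge V u v → Edge V v u
  edge-sym (vertex-u , vertex-v , u≢v , w , wu≡wv , bound , onFace) =
    vertex-v , vertex-u , u≢v ∘ sym , w , sym wu≡wv ,
    (λ x x∈V → subst (⟨ w , x ⟩ ≤_) wu≡wv (bound x x∈V)) ,
    λ x x∈V wx≡wv → inSegment-sym (onFace x x∈V (trans wx≡wv (sym wu≡wv)))

  -- If [u,v] were an edge exposed by w, then x and y, whose weighted average is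
  -- also one of u and v, would reach the maximum of w, so x would lie on [u,v];
  -- but g is constant on [u,v] and takes another value at x.
  not-edge : ∀ {u v x y} α β γ δ g → x ∈ V → y ∈ V → 0ℚ < γ → 0ℚ < δ → α + β ≡ γ + δ →
    α ·v u +v β ·v v ≡ γ ·v x +v δ ·v y → ⟨ g , u ⟩ ≡ ⟨ g , v ⟩ → ⟨ g , x ⟩ ≢ ⟨ g , u ⟩ → ¬ Edge V u v
  not-edge {u} {v} {x} {y} α β γ δ g x∈V y∈V 0<γ 0<δ α+β≡γ+δ relation gu≡gv gx≢gu (_ , _ , _ , w , wu≡wv , bound , onFace) =
    gx≢gu (inSegment-level g (onFace x x∈V (≤-antisym (bound x x∈V) M≤wx)) gu≡gv)
    where
    M = ⟨ w , u ⟩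
    averages : α * M + β * M ≡ γ * ⟨ w , x ⟩ + δ * ⟨ w , y ⟩
    averages = begin
      α * M + β * M                 ≡⟨ cong (λ m → α * M + β * m) wu≡wv ⟩
      α * M + β * ⟨ w , v ⟩         ≡⟨ sym (⟨⟩-combinationʳ w α β u v) ⟩
      ⟨ w , α ·v u +v β ·v v ⟩      ≡⟨ cong ⟨ w ,_⟩ relation ⟩
      ⟨ w , γ ·v x +v δ ·v y ⟩      ≡⟨ ⟨⟩-combinationʳ w γ δ x y ⟩
      γ * ⟨ w , x ⟩ + δ * ⟨ w , y ⟩ ∎
      where open ≡-Reasoning
    balance : γ * (M - ⟨ w , x ⟩) ≡ δ * (⟨ w , y ⟩ - M)
    balance = begin
      γ * (M - ⟨ w , x ⟩)
        ≡⟨ solve 5 (λ γ δ M wx wy → γ :* (M :- wx) := ((γ :+ δ) :* M :- (γ :* wx :+ δ :* wy)) :+ δ :* (wy :- M))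
             refl γ δ M ⟨ w , x ⟩ ⟨ w , y ⟩ ⟩
      ((γ + δ) * M - (γ * ⟨ w , x ⟩ + δ * ⟨ w , y ⟩)) + δ * (⟨ w , y ⟩ - M)
        ≡⟨ cong₂ (λ s t → (s * M - t) + δ * (⟨ w , y ⟩ - M)) (sym α+β≡γ+δ) (sym averages) ⟩
      ((α + β) * M - (α * M + β * M)) + δ * (⟨ w , y ⟩ - M)
        ≡⟨ solve 4 (λ α β M t → ((α :+ β) :* M :- (α :* M :+ β :* M)) :+ t := t) refl α β M _ ⟩
      δ * (⟨ w , y ⟩ - M) ∎
      where open ≡-Reasoning
    M≤wx : M ≤ ⟨ w , x ⟩
    M≤wx = p-q≤0⇒p≤q (*-cancelˡ-≤0 0<γ (subst (_≤ 0ℚ) (sym balance) (nonNeg*nonPos≤0 (<⇒≤ 0<δ) (p≤q⇒p-q≤0 (bound y y∈V)))))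

-- Coherent monotone paths

module Coherence (V : List Point) (c ω : Point) where
  open Certificates V

  C W : Point → ℚ
  C x = ⟨ c , x ⟩
  W x = ⟨ ω , x ⟩

  normal : ℚ → ℚ → Point
  normal a b = a ·v c +v b ·v ω

  ⟨normal⟩ : ∀ a b x → ⟨ normal a b , x ⟩ ≡ a * C x + b * W x
  ⟨normal⟩ a b x = ⟨⟩-combinationˡ a b c ω x

  -- Twice the signed area of the triangle π x, π y, π z, where π = (C , W):
  -- negative iff the polygonal line π x, π y, π z turns clockwise at π y.
  turn : Point → Point → Point → ℚ
  turn x y z = (C y - C x) * (W z - W y) - (C z - C y) * (W y - W x)

  Concave : ∀ {n} → Vec Point n → Set
  Concave (x ∷ y ∷ z ∷ r) = C x < C y × C y < C z × turn x y z < 0ℚ × Concave (y ∷ z ∷ r)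
  Concave _ = ⊤

  BelowEdge : ∀ {ℓ} → Vec Point (suc ℓ) → Point → Fin ℓ → Set
  BelowEdge p x j = C (lookup p (inject₁ j)) ≤ C x × C x ≤ C (lookup p (suc j)) ×
    turn (lookup p (inject₁ j)) (lookup p (suc j)) x < 0ℚ

  UnderPath : ∀ {ℓ} → Vec Point (suc ℓ) → Point → Set
  UnderPath p x = (∃[ i ] x ≡ lookup p i) ⊎ (∃[ j ] BelowEdge p x j)

  concave⇒peaked : ∀ a b → 0ℚ < b → ∀ {n} (p : Vec Point n) → Concave p → Peaked (Vec.map ⟨ normal a b ,_⟩ p)
  concave⇒peaked a b 0<b [] _ = tt
  concave⇒peaked a b 0<b (x ∷ []) _ = tt
  concave⇒peaked a b 0<b (x ∷ y ∷ []) _ = tt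
  concave⇒peaked a b 0<b (x ∷ y ∷ z ∷ r) (Cx<Cy , Cy<Cz , turn<0 , concave) =
    (λ Fy≤Fx → subst₂ _<_ (sym (⟨normal⟩ a b z)) (sym (⟨normal⟩ a b y))
      (concave-step a b (C x) (C y) (C z) (W x) (W y) (W z) 0<b Cx<Cy Cy<Cz turn<0
        (subst₂ _≤_ (⟨normal⟩ a b y) (⟨normal⟩ a b x) Fy≤Fx))) ,
    concave⇒peaked a b 0<b (y ∷ z ∷ r) concave

  module UpperFaces {ℓ} (p : Vec Point (suc ℓ)) (p∈V : ∀ i → lookup p i ∈ V)
    (increasing : ∀ j → C (lookup p (inject₁ j)) < C (lookup p (suc j)))
    (concave : Concave p) (under : All (UnderPath p) V) (a b : ℚ) (0<b : 0ℚ < b) where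

    F : Point → ℚ
    F = ⟨ normal a b ,_⟩

    below-edge : ∀ {x} j → BelowEdge p x j → F x < F (lookup p (inject₁ j)) ⊎ F x < F (lookup p (suc j))
    below-edge {x} j (Cu≤Cx , Cx≤Cv , turn<0)
      with below-chord a b (C (lookup p (inject₁ j))) (C (lookup p (suc j))) (C x)
             (W (lookup p (inject₁ j))) (W (lookup p (suc j))) (W x) 0<b (increasing j) Cu≤Cx Cx≤Cv turn<0
    ... | inj₁ lt = inj₁ (subst₂ _<_ (sym (⟨normal⟩ a b x)) (sym (⟨normal⟩ a b _)) lt)
    ... | inj₂ lt = inj₂ (subst₂ _<_ (sym (⟨normal⟩ a b x)) (sym (⟨normal⟩ a b _)) lt)

    argmax-on-path : ∀ k → (∀ i → F (lookup p i) ≤ F (lookup p k)) →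
      Argmax V (normal a b) (lookup p k) ×
      (∀ x → Argmax V (normal a b) x → ∃[ i ] (x ≡ lookup p i × F (lookup p k) ≤ F (lookup p i)))
    argmax-on-path k highest = (p∈V k , bound) , maximiser
      where
      strictly-below : ∀ {x} → ∃[ j ] BelowEdge p x j → F x < F (lookup p k)
      strictly-below (j , below) with below-edge j below
      ... | inj₁ lt = <-≤-trans lt (highest (inject₁ j))
      ... | inj₂ lt = <-≤-trans lt (highest (suc j))
      bound : ∀ y → y ∈ V → F y ≤ F (lookup p k)
      bound y y∈V with All.lookup under y∈V
      ... | inj₁ (i , refl) = highest i
      ... | inj₂ below = <⇒≤ (strictly-below below)
      maximiser : ∀ x → Argmax V (normal a b) x → ∃[ i ] (x ≡ lookup p i × F (lookup p k) ≤ F (lookup p i))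
      maximiser x (x∈V , x-max) with All.lookup under x∈V
      ... | inj₁ (i , refl) = i , refl , x-max _ (p∈V k)
      ... | inj₂ below = ⊥-elim (<⇒≱ (strictly-below below) (x-max _ (p∈V k)))

    values : ∀ j → lookup (Vec.map F p) j ≡ F (lookup p j)
    values j = Vecₚ.lookup-map j F p

    upper-face : (∃[ i ] PreimageIsVertex V c ω a b (lookup p i)) ⊎
                 (∃[ i ] PreimageIsSegment V c ω a b (lookup p (inject₁ i)) (lookup p (suc i)))
    upper-face with peaked-max (Vec.map F p) (concave⇒peaked a b 0<b p concave)
    ... | inj₁ (k , apex) = inj₁ (k , argmax , unique)
      where
      highest : ∀ i → F (lookup p i) ≤ F (lookup p k)
      highest i = subst₂ _≤_ (values i) (values k) (apex-≤ (Vec.map F p) k apex i)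
      argmax = proj₁ (argmax-on-path k highest)
      unique : ∀ x → Argmax V (normal a b) x → x ≡ lookup p k
      unique x x-max with proj₂ (argmax-on-path k highest) x x-max
      ... | i , refl , high with i Fin.≟ k
      ...   | yes refl = refl
      ...   | no i≢k = ⊥-elim (<⇒≱ (subst₂ _<_ (values i) (values k) (apex i i≢k)) high)
    ... | inj₂ (k , plateau@(flat , lower)) = inj₂ (k , argmax , argmax-end , onSegment)
      where
      highest : ∀ i → F (lookup p i) ≤ F (lookup p (inject₁ k))
      highest i = subst₂ _≤_ (values i) (values (inject₁ k)) (plateau-≤ (Vec.map F p) k plateau i)
      argmax = proj₁ (argmax-on-path (inject₁ k) highest)
      level : F (lookup p (inject₁ k)) ≡ F (lookup p (suc k))
      level = trans (sym (values (inject₁ k))) (trans flat (values (suc k)))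
      argmax-end : Argmax V (normal a b) (lookup p (suc k))
      argmax-end = p∈V (suc k) , λ y y∈V → subst (F y ≤_) level (proj₂ argmax y y∈V)
      onSegment : ∀ x → Argmax V (normal a b) x → InSegment (lookup p (inject₁ k)) (lookup p (suc k)) x
      onSegment x x-max with proj₂ (argmax-on-path (inject₁ k) highest) x x-max
      ... | i , refl , high with i Fin.≟ inject₁ k | i Fin.≟ suc k
      ...   | yes refl | _ = inSegment-start _ _
      ...   | no _ | yes refl = inSegment-end _ _
      ...   | no i≢k | no i≢k+1 = ⊥-elim (<⇒≱ (subst₂ _<_ (values i) (values (inject₁ k)) (lower i i≢k i≢k+1)) high)

  path-in-V : ∀ {ℓ} (p : Vec Point (suc ℓ)) → MonotonePath V c ℓ p → ∀ i → lookup p i ∈ V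
  path-in-V p (start , _) zero = proj₁ start
  path-in-V p (_ , _ , steps) (suc i) = edge-end∈V (proj₁ (steps i))

  -- (W u - W v , C v - C u) is orthogonal to π v - π u, and points upwards when C u < C v.
  edgeNormals : ∀ {ℓ} → Vec Point (suc ℓ) → Vec (ℚ × ℚ) ℓ
  edgeNormals (u ∷ []) = []
  edgeNormals (u ∷ v ∷ r) = (W u - W v , C v - C u) ∷ edgeNormals (v ∷ r)

  -- At a vertex, the sum of the normals of its two edges; at the ends of the path
  -- the missing edge contributes (-1 , 0) resp. (1 , 0).
  vertexNormals : ∀ {ℓ} → Vec (ℚ × ℚ) ℓ → Vec (ℚ × ℚ) (suc ℓ)
  vertexNormals ns = Vec.zipWith (λ (a , b) (a′ , b′) → a + a′ , b + b′) ((- 1ℚ , 0ℚ) ∷ ns) (ns Vec.∷ʳ (1ℚ , 0ℚ))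

  ExposedBy : ℚ × ℚ → Point → Set
  ExposedBy (a , b) v = 0ℚ < b × Maximises (normal a b) v

  SegmentExposedBy : ℚ × ℚ → Point → Point → Set
  SegmentExposedBy (a , b) u v = 0ℚ < b × MaximisesOnSegment (normal a b) u v

  exposed-vertex : ∀ {v} n → v ∈ V → ExposedBy n v → ∃[ a ] ∃[ b ] (0ℚ < b × PreimageIsVertex V c ω a b v)
  exposed-vertex (a , b) v∈V (0<b , max) =
    a , b , 0<b , maximises⇒argmax {normal a b} v∈V max , λ _ → argmax-maximised {normal a b} v∈V max

  exposed-segment : ∀ {u v} n → u ∈ V → v ∈ V → SegmentExposedBy n u v →
    ∃[ a ] ∃[ b ] (0ℚ < b × PreimageIsSegment V c ω a b u v)
  exposed-segment (a , b) u∈V v∈V (0<b , max) =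
    a , b , 0<b , onSegment⇒argmax-start {normal a b} u∈V max , onSegment⇒argmax-end {normal a b} v∈V max , λ _ → onSegment-argmax (normal a b) u∈V max

  CoherenceWitness : ∀ {ℓ} → Vec Point (suc ℓ) → Set
  CoherenceWitness p = Concave p × All (UnderPath p) V ×
    (∀ i → ExposedBy (lookup (vertexNormals (edgeNormals p)) i) (lookup p i)) ×
    (∀ i → SegmentExposedBy (lookup (edgeNormals p) i) (lookup p (inject₁ i)) (lookup p (suc i)))

  coherent : ∀ {ℓ} (p : Vec Point (suc ℓ)) → MonotonePath V c ℓ p → LinearlyIndependent₂ c ω →
    CoherenceWitness p → CoherentMonotonePath V c ℓ p
  coherent p path@(_ , _ , steps) independent (concave , under , vertices , edges) =
    path , ω , independent ,
    UpperFaces.upper-face p p∈V (proj₂ ∘ steps) concave under ,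
    (λ i → exposed-vertex (lookup (vertexNormals (edgeNormals p)) i) (p∈V i) (vertices i)) ,
    (λ i → exposed-segment (lookup (edgeNormals p) i) (p∈V (inject₁ i)) (p∈V (suc i)) (edges i))
    where
    p∈V = path-in-V p path

  concave? : ∀ {n} (p : Vec Point n) → Dec (Concave p)
  concave? (x ∷ y ∷ z ∷ r) = (C x <? C y) ×-dec (C y <? C z) ×-dec (turn x y z <? 0ℚ) ×-dec concave? (y ∷ z ∷ r)
  concave? [] = yes tt
  concave? (_ ∷ []) = yes tt
  concave? (_ ∷ _ ∷ []) = yes tt

  underPath? : ∀ {ℓ} (p : Vec Point (suc ℓ)) x → Dec (UnderPath p x)
  underPath? p x = Finₚ.any? (λ i → x ≟ᵥ lookup p i) ⊎-dec
    Finₚ.any? (λ j → (C (lookup p (inject₁ j)) ≤? C x) ×-dec (C x ≤? C (lookup p (suc j))) ×-dec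
                       (turn (lookup p (inject₁ j)) (lookup p (suc j)) x <? 0ℚ))

  coherenceWitness? : ∀ {ℓ} (p : Vec Point (suc ℓ)) → Dec (CoherenceWitness p)
  coherenceWitness? p = concave? p ×-dec All.all? (underPath? p) V ×-dec
    all-Fin? (λ i → let (a , b) = lookup (vertexNormals (edgeNormals p)) i in (0ℚ <? b) ×-dec maximises? (normal a b) (lookup p i)) ×-dec
    all-Fin? (λ i → let (a , b) = lookup (edgeNormals p) i in (0ℚ <? b) ×-dec maximisesOnSegment? (normal a b) (lookup p (inject₁ i)) (lookup p (suc i)))

-- Finite sums and homogeneous linear systems

qsum-cong : ∀ {k} {f g : Fin k → ℚ} → (∀ i → f i ≡ g i) → qsum f ≡ qsum g
qsum-cong {zero} f≗g = refl
qsum-cong {suc k} f≗g = cong₂ _+_ (f≗g zero) (qsum-cong (f≗g ∘ suc))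

qsum-zero : ∀ {k} {f : Fin k → ℚ} → (∀ i → f i ≡ 0ℚ) → qsum f ≡ 0ℚ
qsum-zero {zero} _ = refl
qsum-zero {suc k} f≗0 = trans (cong₂ _+_ (f≗0 zero) (qsum-zero (f≗0 ∘ suc))) (+-identityˡ 0ℚ)

qsum-+ : ∀ {k} (f g : Fin k → ℚ) → qsum (λ i → f i + g i) ≡ qsum f + qsum g
qsum-+ {zero} f g = refl
qsum-+ {suc k} f g rewrite qsum-+ (f ∘ suc) (g ∘ suc) =
  solve 4 (λ a b x y → (a :+ b) :+ (x :+ y) := (a :+ x) :+ (b :+ y)) refl (f zero) (g zero) (qsum (f ∘ suc)) (qsum (g ∘ suc))

qsum-*ˡ : ∀ {k} a (f : Fin k → ℚ) → qsum (λ i → a * f i) ≡ a * qsum f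
qsum-*ˡ {zero} a f = sym (*-zeroʳ a)
qsum-*ˡ {suc k} a f rewrite qsum-*ˡ a (f ∘ suc) = sym (*-distribˡ-+ a (f zero) (qsum (f ∘ suc)))

qsum-punchIn : ∀ {k} (j : Fin (suc k)) (f : Fin (suc k) → ℚ) → qsum f ≡ f j + qsum (f ∘ Fin.punchIn j)
qsum-punchIn zero f = refl
qsum-punchIn {suc k} (suc j) f rewrite qsum-punchIn j (f ∘ suc) =
  solve 3 (λ a b s → a :+ (b :+ s) := b :+ (a :+ s)) refl (f zero) (f (suc j)) (qsum (f ∘ suc ∘ Fin.punchIn j))

qsum-single : ∀ {k} (f : Fin k → ℚ) i → (∀ j → j ≡ i ⊎ f j ≡ 0ℚ) → qsum f ≡ f i
qsum-single {suc k} f i others = begin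
  qsum f                          ≡⟨ qsum-punchIn i f ⟩
  f i + qsum (f ∘ Fin.punchIn i)  ≡⟨ cong (f i +_) (qsum-zero vanish) ⟩
  f i + 0ℚ                        ≡⟨ +-identityʳ (f i) ⟩
  f i                             ∎
  where
  open ≡-Reasoning
  vanish : ∀ j → f (Fin.punchIn i j) ≡ 0ℚ
  vanish j with others (Fin.punchIn i j)
  ... | inj₁ punchIn≡i = ⊥-elim (Finₚ.punchInᵢ≢i i j punchIn≡i)
  ... | inj₂ f≡0 = f≡0

qsum-swap : ∀ {m n} (f : Fin m → Fin n → ℚ) → qsum (λ r → qsum (f r)) ≡ qsum (λ i → qsum (λ r → f r i))
qsum-swap {zero} {n} f = sym (qsum-zero {n} {λ _ → 0ℚ} (λ _ → refl))
qsum-swap {suc m} f rewrite qsum-swap (f ∘ suc) = sym (qsum-+ (f zero) (λ i → qsum (λ r → f (suc r) i)))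

lookup-vsum : ∀ {k} (f : Fin k → Point) r → lookup (vsum f) r ≡ qsum (λ i → lookup (f i) r)
lookup-vsum {zero} f r = Vecₚ.lookup-replicate r 0ℚ
lookup-vsum {suc k} f r = trans (Vecₚ.lookup-zipWith _+_ r (f zero) (vsum (f ∘ suc)))
  (cong (lookup (f zero) r +_) (lookup-vsum (f ∘ suc) r))

-- Eliminating column j with the pivot A 0 j: a solution μ of the reduced system,
-- extended by the value at j that makes row 0 vanish, solves the whole system.
module Pivot {m n} (A : Fin (suc m) → Fin (suc n) → ℚ) (j : Fin (suc n)) (pivot≢0 : A zero j ≢ 0ℚ) where
  instance _ = ≢-nonZero pivot≢0

  a⁻¹ : ℚ
  a⁻¹ = 1/ A zero j

  factor : Fin m → ℚ
  factor r = A (suc r) j * a⁻¹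

  reduced : Fin m → Fin n → ℚ
  reduced r i = A (suc r) (Fin.punchIn j i) - factor r * A zero (Fin.punchIn j i)

  extend : (Fin n → ℚ) → Fin (suc n) → ℚ
  extend μ = insertAt μ j (- (qsum (λ i → A zero (Fin.punchIn j i) * μ i) * a⁻¹))

  extend-punchIn : ∀ μ i → extend μ (Fin.punchIn j i) ≡ μ i
  extend-punchIn μ = VecFₚ.insertAt-punchIn μ j _

  module _ (μ : Fin n → ℚ) (solves : ∀ r → qsum (λ i → reduced r i * μ i) ≡ 0ℚ) where
    S : ℚ
    S = qsum (λ i → A zero (Fin.punchIn j i) * μ i)

    split : ∀ r → qsum (λ i → A r i * extend μ i) ≡ A r j * - (S * a⁻¹) + qsum (λ i → A r (Fin.punchIn j i) * μ i)
    split r = trans (qsum-punchIn j (λ i → A r i * extend μ i))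
      (cong₂ _+_ (cong (A r j *_) (VecFₚ.insertAt-lookup μ j _))
                 (qsum-cong (λ i → cong (A r (Fin.punchIn j i) *_) (VecFₚ.insertAt-punchIn μ j _ i))))

    lower-rows : ∀ r → qsum (λ i → A (suc r) (Fin.punchIn j i) * μ i) ≡ factor r * S
    lower-rows r = begin
      qsum (λ i → A (suc r) (Fin.punchIn j i) * μ i)
        ≡⟨ qsum-cong (λ i → solve 4 (λ x k y u → x :* u := (x :- k :* y) :* u :+ k :* (y :* u)) refl
             (A (suc r) (Fin.punchIn j i)) (factor r) (A zero (Fin.punchIn j i)) (μ i)) ⟩
      qsum (λ i → reduced r i * μ i + factor r * (A zero (Fin.punchIn j i) * μ i))
        ≡⟨ qsum-+ (λ i → reduced r i * μ i) (λ i → factor r * (A zero (Fin.punchIn j i) * μ i)) ⟩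
      qsum (λ i → reduced r i * μ i) + qsum (λ i → factor r * (A zero (Fin.punchIn j i) * μ i))
        ≡⟨ cong₂ _+_ (solves r) (qsum-*ˡ (factor r) (λ i → A zero (Fin.punchIn j i) * μ i)) ⟩
      0ℚ + factor r * S
        ≡⟨ +-identityˡ _ ⟩
      factor r * S ∎
      where open ≡-Reasoning

    extend-solves : ∀ r → qsum (λ i → A r i * extend μ i) ≡ 0ℚ
    extend-solves zero = begin
      qsum (λ i → A zero i * extend μ i) ≡⟨ split zero ⟩
      A zero j * - (S * a⁻¹) + S          ≡⟨ solve 3 (λ a a⁻¹ S → a :* (:- (S :* a⁻¹)) :+ S := S :* (con 1ℚ :- a :* a⁻¹)) refl (A zero j) a⁻¹ S ⟩
      S * (1ℚ - A zero j * a⁻¹)           ≡⟨ cong (λ x → S * (1ℚ - x)) (*-inverseʳ (A zero j)) ⟩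
      S * (1ℚ - 1ℚ)                       ≡⟨ *-zeroʳ S ⟩
      0ℚ                                  ∎
      where open ≡-Reasoning
    extend-solves (suc r) = begin
      qsum (λ i → A (suc r) i * extend μ i)         ≡⟨ split (suc r) ⟩
      A (suc r) j * - (S * a⁻¹) + qsum (λ i → A (suc r) (Fin.punchIn j i) * μ i)
                                                    ≡⟨ cong (A (suc r) j * - (S * a⁻¹) +_) (lower-rows r) ⟩
      A (suc r) j * - (S * a⁻¹) + factor r * S      ≡⟨ solve 3 (λ x a⁻¹ S → x :* (:- (S :* a⁻¹)) :+ (x :* a⁻¹) :* S := con 0ℚ) refl (A (suc r) j) a⁻¹ S ⟩
      0ℚ                                            ∎
      where open ≡-Reasoning

kernel-nontrivial : ∀ m n → m ℕ.< n → (A : Fin m → Fin n → ℚ) →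
  Σ[ λ′ ∈ (Fin n → ℚ) ] ((∀ r → qsum (λ i → A r i * λ′ i) ≡ 0ℚ) × ∃[ i ] λ′ i ≢ 0ℚ)
kernel-nontrivial zero (suc n) _ A = (λ _ → 1ℚ) , (λ ()) , zero , 1≢0
kernel-nontrivial (suc m) (suc n) (ℕ.s≤s m<n) A with Finₚ.any? (λ j → ¬? (A zero j ≟ 0ℚ))
... | no no-pivot with kernel-nontrivial m (suc n) (ℕₚ.m<n⇒m<1+n m<n) (A ∘ suc)
...   | λ′ , solves , nonzero = λ′ , rows , nonzero
  where
  rows : ∀ r → qsum (λ i → A r i * λ′ i) ≡ 0ℚ
  rows zero = qsum-zero (λ i → trans (cong (_* λ′ i) (decidable-stable (A zero i ≟ 0ℚ) (λ a≢0 → no-pivot (i , a≢0)))) (*-zeroˡ (λ′ i)))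
  rows (suc r) = solves r
kernel-nontrivial (suc m) (suc n) (ℕ.s≤s m<n) A | yes (j , pivot≢0)
  with kernel-nontrivial m n m<n (Pivot.reduced A j pivot≢0)
... | μ , solves , i , μi≢0 =
  Pivot.extend A j pivot≢0 μ , Pivot.extend-solves A j pivot≢0 μ solves ,
  Fin.punchIn j i , λ λi≡0 → μi≢0 (trans (sym (Pivot.extend-punchIn A j pivot≢0 μ i)) λi≡0)

-- Affine dimension

coordinates-vanish : ∀ {k} (λ′ : Fin k → ℚ) (p : Fin k → Point) → vsum (λ i → λ′ i ·v p i) ≡ zeroP →
  ∀ r → qsum (λ i → lookup (p i) r * λ′ i) ≡ 0ℚ
coordinates-vanish λ′ p combination≡0 r = begin
  qsum (λ i → lookup (p i) r * λ′ i)  ≡⟨ qsum-cong (λ i → trans (*-comm _ (λ′ i)) (sym (Vecₚ.lookup-map r (λ′ i *_) (p i)))) ⟩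
  qsum (λ i → lookup (λ′ i ·v p i) r) ≡⟨ sym (lookup-vsum (λ i → λ′ i ·v p i) r) ⟩
  lookup (vsum (λ i → λ′ i ·v p i)) r ≡⟨ cong (λ v → lookup v r) combination≡0 ⟩
  lookup zeroP r                      ≡⟨ Vecₚ.lookup-replicate r 0ℚ ⟩
  0ℚ                                  ∎
  where open ≡-Reasoning

-- The coefficient sum of an affine dependence is forced to vanish by the hyperplane,
-- so any linear dependence of seven vectors in ℚ⁶ is an affine one.
on-hyperplane⇒dependent : ∀ s → s ≢ 0ℚ → (p : Fin 7 → Point) → (∀ i → qsum (λ r → lookup (p i) r) ≡ s) →
  ¬ AffinelyIndependent p
on-hyperplane⇒dependent s s≢0 p on-plane independent
  with kernel-nontrivial 6 7 (ℕₚ.n<1+n 6) (λ r i → lookup (p i) r)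
... | λ′ , solves , i , λi≢0 = λi≢0 (independent λ′ sum≡0 combination≡0 i)
  where
  combination≡0 : vsum (λ i → λ′ i ·v p i) ≡ zeroP
  combination≡0 = ≗⇒≡ λ r → begin
    lookup (vsum (λ i → λ′ i ·v p i)) r ≡⟨ lookup-vsum (λ i → λ′ i ·v p i) r ⟩
    qsum (λ i → lookup (λ′ i ·v p i) r) ≡⟨ qsum-cong (λ i → trans (Vecₚ.lookup-map r (λ′ i *_) (p i)) (*-comm (λ′ i) _)) ⟩
    qsum (λ i → lookup (p i) r * λ′ i)  ≡⟨ solves r ⟩
    0ℚ                                  ≡⟨ sym (Vecₚ.lookup-replicate r 0ℚ) ⟩
    lookup zeroP r                      ∎
    where open ≡-Reasoning
  sum≡0 : qsum λ′ ≡ 0ℚ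
  sum≡0 = *-cancelʳ-≡0 (qsum λ′) s s≢0 (begin
    qsum λ′ * s                                         ≡⟨ *-comm (qsum λ′) s ⟩
    s * qsum λ′                                         ≡⟨ sym (qsum-*ˡ s λ′) ⟩
    qsum (λ i → s * λ′ i)                               ≡⟨ qsum-cong spread ⟩
    qsum (λ i → qsum (λ r → lookup (p i) r * λ′ i))     ≡⟨ qsum-swap (λ i r → lookup (p i) r * λ′ i) ⟩
    qsum {6} (λ r → qsum (λ i → lookup (p i) r * λ′ i)) ≡⟨ qsum-zero solves ⟩
    0ℚ                                                  ∎)
    where
    open ≡-Reasoning
    spread : ∀ i → s * λ′ i ≡ qsum (λ r → lookup (p i) r * λ′ i)
    spread i = begin
      s * λ′ i                                ≡⟨ cong (_* λ′ i) (sym (on-plane i)) ⟩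
      qsum (λ r → lookup (p i) r) * λ′ i      ≡⟨ *-comm _ (λ′ i) ⟩
      λ′ i * qsum (λ r → lookup (p i) r)      ≡⟨ sym (qsum-*ˡ (λ′ i) (λ r → lookup (p i) r)) ⟩
      qsum (λ r → λ′ i * lookup (p i) r)      ≡⟨ qsum-cong (λ r → *-comm (λ′ i) (lookup (p i) r)) ⟩
      qsum (λ r → lookup (p i) r * λ′ i)      ∎

Isolates : ∀ {k} → (Fin k → Point) → Fin k → Fin 6 → Set
Isolates p i r = lookup (p i) r ≢ 0ℚ × (∀ j → j ≡ i ⊎ lookup (p j) r ≡ 0ℚ)

isolates? : ∀ {k} (p : Fin k → Point) i r → Dec (Isolates p i r)
isolates? p i r = ¬? (lookup (p i) r ≟ 0ℚ) ×-dec all-Fin? (λ j → (j Fin.≟ i) ⊎-dec (lookup (p j) r ≟ 0ℚ))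

-- The coordinate isolating a point kills every coefficient but its own, and
-- the coefficient sum then kills the remaining one.
affinelyIndependent-by-isolation : ∀ {k} (p : Fin (suc k) → Point) → (∀ i → ∃[ r ] Isolates p (suc i) r) →
  AffinelyIndependent p
affinelyIndependent-by-isolation p isolated λ′ sum≡0 combination≡0 = coefficient
  where
  later : ∀ i → λ′ (suc i) ≡ 0ℚ
  later i with isolated i
  ... | r , pr≢0 , others = *-cancelʳ-≡0 (λ′ (suc i)) (lookup (p (suc i)) r) pr≢0 (begin
    λ′ (suc i) * lookup (p (suc i)) r     ≡⟨ *-comm (λ′ (suc i)) _ ⟩
    lookup (p (suc i)) r * λ′ (suc i)     ≡⟨ sym (qsum-single (λ j → lookup (p j) r * λ′ j) (suc i) vanish) ⟩
    qsum (λ j → lookup (p j) r * λ′ j)    ≡⟨ coordinates-vanish λ′ p combination≡0 r ⟩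
    0ℚ                                    ∎)
    where
    open ≡-Reasoning
    vanish : ∀ j → j ≡ suc i ⊎ lookup (p j) r * λ′ j ≡ 0ℚ
    vanish j = map₂ (λ pr≡0 → trans (cong (_* λ′ j) pr≡0) (*-zeroˡ (λ′ j))) (others j)
  coefficient : ∀ i → λ′ i ≡ 0ℚ
  coefficient zero = trans (sym (trans (cong (λ′ zero +_) (qsum-zero later)) (+-identityʳ (λ′ zero)))) sum≡0
  coefficient (suc i) = later i

-- The example

-- From here on, numerals are overloaded: they denote rationals, naturals or elements of Fin n.
open FromNat using (Number; fromNat)
open FromNeg using (Negative; fromNeg)

instance
  literal-constraint : ⊤
  literal-constraint = tt
  ℕ-number : Number ℕ
  ℕ-number = ℕ-Literals.number
  ℚ-number : Number ℚ
  ℚ-number = ℚ-Literals.number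
  ℚ-negative : Negative ℚ
  ℚ-negative = ℚ-Literals.negative
  Fin-number : ∀ {n} → Number (Fin n)
  Fin-number = Fin-Literals.number _

-- The data below are opaque, and the facts about them that are decided by evaluation
-- live in opaque blocks unfolding them; otherwise the type checker keeps expanding
-- the data and the decision procedures wherever they occur in types.
opaque
  vertices : Vec Point 10
  vertices =
    (0 ∷ 0 ∷ 0 ∷ 2 ∷ 0 ∷ 0 ∷ [])
    ∷ (0 ∷ 1 ∷ 0 ∷ 1 ∷ 0 ∷ 0 ∷ [])
    ∷ (0 ∷ 0 ∷ 0 ∷ 1 ∷ 0 ∷ 1 ∷ [])
    ∷ (0 ∷ 0 ∷ 0 ∷ 1 ∷ 1 ∷ 0 ∷ [])
    ∷ (0 ∷ 0 ∷ 1 ∷ 1 ∷ 0 ∷ 0 ∷ [])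
    ∷ (1 ∷ 1 ∷ 0 ∷ 0 ∷ 0 ∷ 0 ∷ [])
    ∷ (1 ∷ 0 ∷ 0 ∷ 0 ∷ 0 ∷ 1 ∷ [])
    ∷ (1 ∷ 0 ∷ 0 ∷ 0 ∷ 1 ∷ 0 ∷ [])
    ∷ (1 ∷ 0 ∷ 1 ∷ 0 ∷ 0 ∷ 0 ∷ [])
    ∷ (2 ∷ 0 ∷ 0 ∷ 0 ∷ 0 ∷ 0 ∷ [])
    ∷ []

  c : Point
  c = 11 ∷ 2 ∷ 10 ∷ 0 ∷ 8 ∷ 3 ∷ []

pt : Fin 10 → Point
pt = lookup vertices

V : List Point
V = List.map pt (List.allFin 10)

open Certificates V

C : Point → ℚ
C = ⟨ c ,_⟩

pt∈V : ∀ i → pt i ∈ V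
pt∈V i = ∈-map⁺ pt (∈-allFin i)

∈V⇒pt : ∀ {x} → x ∈ V → ∃[ i ] x ≡ pt i
∈V⇒pt x∈V with ∈-map⁻ pt {xs = List.allFin 10} x∈V
... | i , _ , x≡pt = i , x≡pt

opaque
  unfolding vertices
  C-injective : ∀ i j → C (pt i) ≡ C (pt j) → i ≡ j
  C-injective = from-yes (all-Fin? λ i → all-Fin? λ j → (C (pt i) ≟ C (pt j)) →-dec (i Fin.≟ j))

pt-injective : ∀ {i j} → pt i ≡ pt j → i ≡ j
pt-injective {i} {j} = C-injective i j ∘ cong C

-- Subtracting e₀ + e₃ breaks the ties of eₖ + e₀ and eₖ + e₃ with 2e₀ and 2e₃.
vertexNormal : Point → Point
vertexNormal u = u -v (e 0 +v e 3)

opaque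
  unfolding vertices
  vertices-exposed : ∀ i → Maximises (vertexNormal (pt i)) (pt i)
  vertices-exposed = from-yes (all-Fin? λ i → maximises? (vertexNormal (pt i)) (pt i))

pt-vertex : ∀ i → Vertex V (pt i)
pt-vertex i = vertex (vertexNormal (pt i)) (pt∈V i) (vertices-exposed i)

opaque
  unfolding vertices
  c-minimised : Minimises c (pt 0)
  c-minimised = from-yes (minimises? c (pt 0))

  c-maximised : Maximises c (pt 9)
  c-maximised = from-yes (maximises? c (pt 9))

bottom : IsUniqueMin V c (pt 0)
bottom = uniqueMin c (pt∈V 0) c-minimised

top : IsUniqueMax V c (pt 9)
top = uniqueMax c (pt∈V 9) c-maximised

-- The edges leaving each vertex upwards, each with a functional exposing it.
opaque
  outArcs : Vec (List (Fin 10 × Point)) 10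
  outArcs =
    ( (1 , (0 ∷ 1 ∷ -1 ∷ 1 ∷ -2 ∷ -2 ∷ []))
      ∷ (2 , (-3 ∷ -3 ∷ -1 ∷ 0 ∷ -3 ∷ 0 ∷ []))
      ∷ (3 , (-1 ∷ -1 ∷ 0 ∷ 1 ∷ 1 ∷ -2 ∷ []))
      ∷ (4 , (0 ∷ -1 ∷ 3 ∷ 3 ∷ -2 ∷ -1 ∷ []))
      ∷ (9 , (3 ∷ -2 ∷ -2 ∷ 3 ∷ 0 ∷ -1 ∷ []))
      ∷ [])
    ∷ ( (2 , (-2 ∷ 0 ∷ -3 ∷ -1 ∷ -3 ∷ 0 ∷ []))
      ∷ (3 , (-3 ∷ 3 ∷ -3 ∷ -2 ∷ 3 ∷ -3 ∷ []))
      ∷ (4 , (-3 ∷ 3 ∷ 3 ∷ 1 ∷ -1 ∷ -2 ∷ []))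
      ∷ (5 , (1 ∷ 2 ∷ -2 ∷ 1 ∷ -1 ∷ 1 ∷ []))
      ∷ [])
    ∷ ( (3 , (-1 ∷ -3 ∷ 0 ∷ 0 ∷ 1 ∷ 1 ∷ []))
      ∷ (4 , (-2 ∷ 1 ∷ 3 ∷ 2 ∷ -2 ∷ 3 ∷ []))
      ∷ (6 , (-2 ∷ -3 ∷ -1 ∷ -2 ∷ -2 ∷ 1 ∷ []))
      ∷ [])
    ∷ ( (4 , (0 ∷ 1 ∷ 3 ∷ 2 ∷ 3 ∷ -2 ∷ []))
      ∷ (7 , (-2 ∷ 2 ∷ -2 ∷ -2 ∷ 3 ∷ 0 ∷ []))
      ∷ [])
    ∷ ( (8 , (-3 ∷ 0 ∷ 3 ∷ -3 ∷ -3 ∷ -1 ∷ []))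
      ∷ [])
    ∷ ( (6 , (1 ∷ 2 ∷ -1 ∷ -1 ∷ -2 ∷ 2 ∷ []))
      ∷ (7 , (0 ∷ 3 ∷ -3 ∷ -3 ∷ 3 ∷ -2 ∷ []))
      ∷ (8 , (-1 ∷ 1 ∷ 1 ∷ -2 ∷ -1 ∷ -3 ∷ []))
      ∷ (9 , (1 ∷ 1 ∷ -2 ∷ 0 ∷ 0 ∷ -1 ∷ []))
      ∷ [])
    ∷ ( (7 , (1 ∷ -2 ∷ 0 ∷ -1 ∷ 3 ∷ 3 ∷ []))
      ∷ (8 , (-2 ∷ -2 ∷ 2 ∷ -3 ∷ -3 ∷ 2 ∷ []))
      ∷ (9 , (1 ∷ 0 ∷ -1 ∷ 0 ∷ -3 ∷ 1 ∷ []))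
      ∷ [])
    ∷ ( (8 , (0 ∷ 1 ∷ 2 ∷ -3 ∷ 2 ∷ 0 ∷ []))
      ∷ (9 , (3 ∷ 1 ∷ 1 ∷ -2 ∷ 3 ∷ -1 ∷ []))
      ∷ [])
    ∷ ( (9 , (1 ∷ -2 ∷ 1 ∷ 0 ∷ -1 ∷ -2 ∷ []))
      ∷ [])
    ∷ []
    ∷ []

successors : Fin 10 → List (Fin 10)
successors i = List.map proj₁ (lookup outArcs i)

opaque
  unfolding vertices outArcs
  arcs-exposed : ∀ i → All (λ (j , w) → C (pt i) < C (pt j) × MaximisesOnSegment w (pt i) (pt j)) (lookup outArcs i)
  arcs-exposed = from-yes (all-Fin? λ i →
    All.all? (λ (j , w) → (C (pt i) <? C (pt j)) ×-dec maximisesOnSegment? w (pt i) (pt j)) (lookup outArcs i))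

arc : ∀ {i j} → j ∈ successors i → Edge V (pt i) (pt j) × C (pt i) < C (pt j)
arc {i} j∈ with ∈-map⁻ proj₁ j∈
... | (j , w) , jw∈ , refl with All.lookup (arcs-exposed i) jw∈
...   | Ci<Cj , exposed = edge w (pt-vertex i) (pt-vertex j) (λ eq → <-irrefl (cong C eq) Ci<Cj) exposed , Ci<Cj

record NonEdgeCertificate : Set where
  constructor nonEdge
  field
    source target left right : Fin 10
    α β γ δ : ℚ
    separator : Point

  endpoints : Fin 10 × Fin 10
  endpoints = source , target

open NonEdgeCertificate

ValidNonEdge : NonEdgeCertificate → Set
ValidNonEdge n = 0ℚ < γ n × 0ℚ < δ n × α n + β n ≡ γ n + δ n ×
  α n ·v pt (source n) +v β n ·v pt (target n) ≡ γ n ·v pt (left n) +v δ n ·v pt (right n) ×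
  ⟨ separator n , pt (source n) ⟩ ≡ ⟨ separator n , pt (target n) ⟩ ×
  ⟨ separator n , pt (left n) ⟩ ≢ ⟨ separator n , pt (source n) ⟩

validNonEdge? : ∀ n → Dec (ValidNonEdge n)
validNonEdge? n = (0ℚ <? γ n) ×-dec (0ℚ <? δ n) ×-dec (α n + β n ≟ γ n + δ n) ×-dec
  (α n ·v pt (source n) +v β n ·v pt (target n) ≟ᵥ γ n ·v pt (left n) +v δ n ·v pt (right n)) ×-dec
  (⟨ separator n , pt (source n) ⟩ ≟ ⟨ separator n , pt (target n) ⟩) ×-dec
  ¬? (⟨ separator n , pt (left n) ⟩ ≟ ⟨ separator n , pt (source n) ⟩)

opaque
  nonEdges : List NonEdgeCertificate
  nonEdges =
    nonEdge 0 5 9 1 1 2 1 2 (0 ∷ 2 ∷ 0 ∷ 1 ∷ 0 ∷ 0 ∷ [])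
    ∷ nonEdge 0 6 9 2 1 2 1 2 (0 ∷ 0 ∷ 0 ∷ 1 ∷ 0 ∷ 2 ∷ [])
    ∷ nonEdge 0 7 9 3 1 2 1 2 (0 ∷ 0 ∷ 0 ∷ 1 ∷ 2 ∷ 0 ∷ [])
    ∷ nonEdge 0 8 9 4 1 2 1 2 (0 ∷ 0 ∷ 2 ∷ 1 ∷ 0 ∷ 0 ∷ [])
    ∷ nonEdge 1 6 2 5 1 1 1 1 (0 ∷ 0 ∷ 0 ∷ 1 ∷ 0 ∷ 1 ∷ [])
    ∷ nonEdge 1 7 3 5 1 1 1 1 (0 ∷ 0 ∷ 0 ∷ 1 ∷ 1 ∷ 0 ∷ [])
    ∷ nonEdge 1 8 4 5 1 1 1 1 (0 ∷ 0 ∷ 1 ∷ 1 ∷ 0 ∷ 0 ∷ [])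
    ∷ nonEdge 1 9 0 5 2 1 1 2 (0 ∷ 1 ∷ 0 ∷ -1 ∷ 0 ∷ 0 ∷ [])
    ∷ nonEdge 2 5 1 6 1 1 1 1 (0 ∷ 0 ∷ 0 ∷ 1 ∷ 0 ∷ -1 ∷ [])
    ∷ nonEdge 2 7 3 6 1 1 1 1 (0 ∷ 0 ∷ 0 ∷ 1 ∷ 0 ∷ -1 ∷ [])
    ∷ nonEdge 2 8 4 6 1 1 1 1 (0 ∷ 0 ∷ 0 ∷ 1 ∷ 0 ∷ -1 ∷ [])
    ∷ nonEdge 2 9 0 6 2 1 1 2 (0 ∷ 0 ∷ 0 ∷ 1 ∷ 0 ∷ -1 ∷ [])
    ∷ nonEdge 3 5 1 7 1 1 1 1 (0 ∷ 0 ∷ 0 ∷ 1 ∷ -1 ∷ 0 ∷ [])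
    ∷ nonEdge 3 6 2 7 1 1 1 1 (0 ∷ 0 ∷ 0 ∷ 1 ∷ 0 ∷ 1 ∷ [])
    ∷ nonEdge 3 8 4 7 1 1 1 1 (0 ∷ 0 ∷ 0 ∷ 1 ∷ -1 ∷ 0 ∷ [])
    ∷ nonEdge 3 9 0 7 2 1 1 2 (0 ∷ 0 ∷ 0 ∷ 1 ∷ -1 ∷ 0 ∷ [])
    ∷ nonEdge 4 5 1 8 1 1 1 1 (0 ∷ 0 ∷ 1 ∷ -1 ∷ 0 ∷ 0 ∷ [])
    ∷ nonEdge 4 6 2 8 1 1 1 1 (0 ∷ 0 ∷ 0 ∷ 1 ∷ 0 ∷ 1 ∷ [])
    ∷ nonEdge 4 7 3 8 1 1 1 1 (0 ∷ 0 ∷ 0 ∷ 1 ∷ 1 ∷ 0 ∷ [])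
    ∷ nonEdge 4 9 0 8 2 1 1 2 (0 ∷ 0 ∷ 1 ∷ -1 ∷ 0 ∷ 0 ∷ [])
    ∷ []

opaque
  unfolding vertices nonEdges
  nonEdges-valid : All ValidNonEdge nonEdges
  nonEdges-valid = from-yes (All.all? validNonEdge? nonEdges)

certified-not-edge : ∀ {n} → n ∈ nonEdges → ¬ Edge V (pt (source n)) (pt (target n))
certified-not-edge {n} n∈ with All.lookup nonEdges-valid n∈
... | 0<γ , 0<δ , weights , relation , level , off =
  not-edge (α n) (β n) (γ n) (δ n) (separator n) (pt∈V (left n)) (pt∈V (right n)) 0<γ 0<δ weights relation level off

open DecMembership (Fin._≟_ {10}) using (_∈?_)
open DecMembership (Productₚ.≡-dec (Fin._≟_ {10}) (Fin._≟_ {10})) using () renaming (_∈?_ to _∈ₚ?_)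

opaque
  unfolding vertices outArcs nonEdges
  ascending-pairs-classified : ∀ i j → C (pt i) < C (pt j) → j ∈ successors i ⊎ (i , j) ∈ List.map endpoints nonEdges
  ascending-pairs-classified = from-yes (all-Fin? λ i → all-Fin? λ j →
    (C (pt i) <? C (pt j)) →-dec ((j ∈? successors i) ⊎-dec ((i , j) ∈ₚ? List.map endpoints nonEdges)))

ascending-edge : ∀ {i j} → Edge V (pt i) (pt j) → C (pt i) < C (pt j) → j ∈ successors i
ascending-edge {i} {j} E Ci<Cj with ascending-pairs-classified i j Ci<Cj
... | inj₁ j∈ = j∈
... | inj₂ ij∈ with ∈-map⁻ endpoints ij∈
...   | n , n∈ , refl = ⊥-elim (certified-not-edge n∈ E)

RootDirection : Point → Point → Set
RootDirection u v = ∃[ a ] ∃[ b ] (a ≢ b × v -v u ≡ lookup (v -v u) a ·v (e a -v e b))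

rootDirection? : ∀ u v → Dec (RootDirection u v)
rootDirection? u v = Finₚ.any? λ a → Finₚ.any? λ b → ¬? (a Fin.≟ b) ×-dec (v -v u ≟ᵥ lookup (v -v u) a ·v (e a -v e b))

opaque
  unfolding vertices outArcs
  arcs-along-roots : ∀ i → All (λ j → RootDirection (pt i) (pt j) × RootDirection (pt j) (pt i)) (successors i)
  arcs-along-roots = from-yes (all-Fin? λ i →
    All.all? (λ j → rootDirection? (pt i) (pt j) ×-dec rootDirection? (pt j) (pt i)) (successors i))

root⇒parallel : ∀ {u v} → RootDirection u v → ∃[ a ] ∃[ b ] (a ≢ b × ∃[ λ′ ] (v -v u ≡ λ′ ·v (e a -v e b)))
root⇒parallel {u} {v} (a , b , a≢b , v-u≡) = a , b , a≢b , lookup (v -v u) a , v-u≡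

generalized-permutahedron : GenPermutahedron V
generalized-permutahedron u v E@((u∈V , _) , (v∈V , _) , u≢v , _) with ∈V⇒pt u∈V | ∈V⇒pt v∈V
... | i , refl | j , refl with <-cmp (C (pt i)) (C (pt j))
... | tri< Ci<Cj _ _ = root⇒parallel (proj₁ (All.lookup (arcs-along-roots i) (ascending-edge {i} {j} E Ci<Cj)))
... | tri≈ _ Ci≡Cj _ = ⊥-elim (u≢v (cong pt (C-injective i j Ci≡Cj)))
... | tri> _ _ Cj<Ci = root⇒parallel (proj₂ (All.lookup (arcs-along-roots j) (ascending-edge {j} {i} (edge-sym E) Cj<Ci)))

opaque
  unfolding vertices
  on-hyperplane : ∀ i → qsum (λ r → lookup (pt i) r) ≡ 2
  on-hyperplane = from-yes (all-Fin? λ i → qsum (λ r → lookup (pt i) r) ≟ 2)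

basisIndices : Vec (Fin 10) 6
basisIndices = 0 ∷ 1 ∷ 4 ∷ 3 ∷ 2 ∷ 9 ∷ []

basis : Fin 6 → Point
basis = pt ∘ lookup basisIndices

opaque
  unfolding vertices
  basis-isolated : ∀ i → ∃[ r ] Isolates basis (suc i) r
  basis-isolated = from-yes (all-Fin? λ i → Finₚ.any? λ r → isolates? basis (suc i) r)

dimension : HasDimension V 5
dimension =
  (basis , (pt∈V ∘ lookup basisIndices) , affinelyIndependent-by-isolation basis basis-isolated) ,
  λ p p∈V → on-hyperplane⇒dependent 2 (λ ()) p (λ i → on-plane (p∈V i))
  where
  on-plane : ∀ {x} → x ∈ V → qsum (λ r → lookup x r) ≡ 2
  on-plane x∈V with ∈V⇒pt x∈V
  ... | i , refl = on-hyperplane i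

walks : (ℓ : ℕ) → Fin 10 → List (Vec (Fin 10) (suc ℓ))
walks zero i with i Fin.≟ 9
... | yes _ = (i ∷ []) ∷ []
... | no _ = []
walks (suc ℓ) i = List.concatMap (λ j → List.map (i ∷_) (walks ℓ j)) (successors i)

∈-walks⁺ : ∀ {ℓ i j} {js : Vec (Fin 10) (suc ℓ)} → j ∈ successors i → js ∈ walks ℓ j → i ∷ js ∈ walks (suc ℓ) i
∈-walks⁺ {i = i} j∈ js∈ = ∈-concat⁺′ (∈-map⁺ (i ∷_) js∈) (∈-map⁺ _ j∈)

∈-walks⁻ : ∀ {ℓ i} {js : Vec (Fin 10) (suc (suc ℓ))} → js ∈ walks (suc ℓ) i →
  ∃[ j ] ∃[ ks ] (j ∈ successors i × ks ∈ walks ℓ j × js ≡ i ∷ ks)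
∈-walks⁻ {ℓ} {i} js∈ with ∈-concat⁻′ (List.map (λ j → List.map (i ∷_) (walks ℓ j)) (successors i)) js∈
... | _ , js∈xs , xs∈ with ∈-map⁻ _ xs∈
...   | j , j∈ , refl with ∈-map⁻ _ js∈xs
...     | ks , ks∈ , refl = j , ks , j∈ , ks∈ , refl

Climbs : ∀ {ℓ} → Vec Point (suc ℓ) → Set
Climbs {ℓ} p = IsUniqueMax V c (lookup p (fromℕ ℓ)) ×
  (∀ k → Edge V (lookup p (inject₁ k)) (lookup p (suc k)) × C (lookup p (inject₁ k)) < C (lookup p (suc k)))

walk-climbs : ∀ {ℓ i} {js : Vec (Fin 10) (suc ℓ)} → js ∈ walks ℓ i → lookup js zero ≡ i × Climbs (Vec.map pt js)
walk-climbs {zero} {i} js∈ with i Fin.≟ 9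
walk-climbs {zero} {i} (here refl) | yes refl = refl , top , λ ()
walk-climbs {zero} {i} (there ()) | yes _
walk-climbs {zero} {i} () | no _
walk-climbs {suc ℓ} {i} js∈ with ∈-walks⁻ {i = i} js∈
... | j , ks@(_ ∷ _) , j∈ , ks∈ , refl with walk-climbs ks∈
...   | refl , maximal , steps = refl , maximal , λ where
          zero → arc {i} {j} j∈
          (suc k) → steps k

walk-monotone : ∀ {ℓ} {js : Vec (Fin 10) (suc ℓ)} → js ∈ walks ℓ 0 → MonotonePath V c ℓ (Vec.map pt js)
walk-monotone {js = js} js∈ with walk-climbs js∈
... | first , climbs = subst (IsUniqueMin V c) (sym (trans (Vecₚ.lookup-map zero pt js) (cong pt first))) bottom , climbs

climb-walk : ∀ ℓ (p : Vec Point (suc ℓ)) i → lookup p zero ≡ pt i → Climbs p →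
  ∃[ js ] (js ∈ walks ℓ i × p ≡ Vec.map pt js)
climb-walk zero (_ ∷ []) i refl (maximal , _) with pt-injective {i} {9} (uniqueMax-unique {c} top maximal)
... | refl = (9 ∷ []) , here refl , refl
climb-walk (suc ℓ) (_ ∷ _ ∷ r) i refl (maximal , steps) with ∈V⇒pt (edge-end∈V (proj₁ (steps zero)))
... | j , refl with climb-walk ℓ (pt j ∷ r) j refl (maximal , steps ∘ suc)
...   | ks , ks∈ , eq = i ∷ ks , ∈-walks⁺ (ascending-edge {i} {j} (proj₁ (steps zero)) (proj₂ (steps zero))) ks∈ , cong (pt i ∷_) eq

paths : (ℓ : ℕ) → List (Vec Point (suc ℓ))
paths ℓ = List.map (Vec.map pt) (walks ℓ 0)

monotone⇒listed : ∀ {ℓ p} → MonotonePath V c ℓ p → p ∈ paths ℓ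
monotone⇒listed {ℓ} {p} (minimal , climbs) with climb-walk ℓ p 0 (uniqueMin-unique {c} bottom minimal) climbs
... | js , js∈ , refl = ∈-map⁺ (Vec.map pt) js∈

-- The walks of each length, each with an ω exhibiting its coherence.
opaque
  coherenceData : (ℓ : ℕ) → List (Vec (Fin 10) (suc ℓ) × Point)
  coherenceData 1 =
    ((0 ∷ 9 ∷ []) , (0 ∷ 0 ∷ 0 ∷ 1 ∷ 0 ∷ 0 ∷ []))
    ∷ []
  coherenceData 3 =
    ((0 ∷ 1 ∷ 5 ∷ 9 ∷ []) , (1 ∷ 1 ∷ 0 ∷ -1 ∷ 0 ∷ -1 ∷ []))
    ∷ ((0 ∷ 2 ∷ 6 ∷ 9 ∷ []) , (-1 ∷ 0 ∷ -1 ∷ -1 ∷ -1 ∷ 1 ∷ []))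
    ∷ ((0 ∷ 3 ∷ 7 ∷ 9 ∷ []) , (0 ∷ -1 ∷ -1 ∷ 1 ∷ 1 ∷ -1 ∷ []))
    ∷ ((0 ∷ 4 ∷ 8 ∷ 9 ∷ []) , (-1 ∷ -1 ∷ 1 ∷ 1 ∷ 0 ∷ 0 ∷ []))
    ∷ []
  coherenceData 4 =
    ((0 ∷ 1 ∷ 2 ∷ 6 ∷ 9 ∷ []) , (-1 ∷ 2 ∷ -1 ∷ 1 ∷ 0 ∷ 2 ∷ []))
    ∷ ((0 ∷ 1 ∷ 3 ∷ 7 ∷ 9 ∷ []) , (-1 ∷ 0 ∷ -1 ∷ -1 ∷ 1 ∷ 0 ∷ []))
    ∷ ((0 ∷ 1 ∷ 4 ∷ 8 ∷ 9 ∷ []) , (-1 ∷ 0 ∷ 1 ∷ -1 ∷ 0 ∷ -1 ∷ []))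
    ∷ ((0 ∷ 1 ∷ 5 ∷ 6 ∷ 9 ∷ []) , (0 ∷ 1 ∷ 0 ∷ -1 ∷ 0 ∷ 1 ∷ []))
    ∷ ((0 ∷ 1 ∷ 5 ∷ 7 ∷ 9 ∷ []) , (-1 ∷ 1 ∷ -1 ∷ -1 ∷ 0 ∷ 0 ∷ []))
    ∷ ((0 ∷ 1 ∷ 5 ∷ 8 ∷ 9 ∷ []) , (0 ∷ 1 ∷ 1 ∷ -1 ∷ 0 ∷ -1 ∷ []))
    ∷ ((0 ∷ 2 ∷ 3 ∷ 7 ∷ 9 ∷ []) , (0 ∷ -1 ∷ 0 ∷ -1 ∷ 1 ∷ 0 ∷ []))
    ∷ ((0 ∷ 2 ∷ 4 ∷ 8 ∷ 9 ∷ []) , (-1 ∷ 0 ∷ 0 ∷ 1 ∷ -1 ∷ 1 ∷ []))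
    ∷ ((0 ∷ 2 ∷ 6 ∷ 7 ∷ 9 ∷ []) , (-1 ∷ 0 ∷ -1 ∷ -1 ∷ 0 ∷ 1 ∷ []))
    ∷ ((0 ∷ 2 ∷ 6 ∷ 8 ∷ 9 ∷ []) , (1 ∷ -1 ∷ 1 ∷ -1 ∷ 0 ∷ 0 ∷ []))
    ∷ ((0 ∷ 3 ∷ 4 ∷ 8 ∷ 9 ∷ []) , (-2 ∷ -2 ∷ 2 ∷ 1 ∷ 2 ∷ -2 ∷ []))
    ∷ ((0 ∷ 3 ∷ 7 ∷ 8 ∷ 9 ∷ []) , (-1 ∷ -1 ∷ 0 ∷ 1 ∷ 1 ∷ -1 ∷ []))
    ∷ []
  coherenceData 5 =
    ((0 ∷ 1 ∷ 2 ∷ 3 ∷ 7 ∷ 9 ∷ []) , (-2 ∷ 2 ∷ -2 ∷ 1 ∷ 1 ∷ 2 ∷ []))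
    ∷ ((0 ∷ 1 ∷ 2 ∷ 4 ∷ 8 ∷ 9 ∷ []) , (-2 ∷ 2 ∷ 1 ∷ 1 ∷ -2 ∷ 2 ∷ []))
    ∷ ((0 ∷ 1 ∷ 2 ∷ 6 ∷ 7 ∷ 9 ∷ []) , (0 ∷ 1 ∷ -1 ∷ -2 ∷ 1 ∷ 2 ∷ []))
    ∷ ((0 ∷ 1 ∷ 2 ∷ 6 ∷ 8 ∷ 9 ∷ []) , (-2 ∷ 2 ∷ 0 ∷ -1 ∷ -2 ∷ 2 ∷ []))
    ∷ ((0 ∷ 1 ∷ 3 ∷ 4 ∷ 8 ∷ 9 ∷ []) , (-2 ∷ 1 ∷ 2 ∷ -1 ∷ 2 ∷ 1 ∷ []))
    ∷ ((0 ∷ 1 ∷ 3 ∷ 7 ∷ 8 ∷ 9 ∷ []) , (-1 ∷ 0 ∷ 0 ∷ -1 ∷ 1 ∷ 0 ∷ []))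
    ∷ ((0 ∷ 1 ∷ 5 ∷ 6 ∷ 7 ∷ 9 ∷ []) , (-1 ∷ 1 ∷ -1 ∷ -2 ∷ 0 ∷ 1 ∷ []))
    ∷ ((0 ∷ 1 ∷ 5 ∷ 6 ∷ 8 ∷ 9 ∷ []) , (-1 ∷ 2 ∷ 0 ∷ -2 ∷ 0 ∷ 2 ∷ []))
    ∷ ((0 ∷ 1 ∷ 5 ∷ 7 ∷ 8 ∷ 9 ∷ []) , (-1 ∷ 2 ∷ 1 ∷ -2 ∷ 2 ∷ 0 ∷ []))
    ∷ ((0 ∷ 2 ∷ 3 ∷ 4 ∷ 8 ∷ 9 ∷ []) , (-2 ∷ -1 ∷ 1 ∷ -1 ∷ 1 ∷ 0 ∷ []))
    ∷ ((0 ∷ 2 ∷ 3 ∷ 7 ∷ 8 ∷ 9 ∷ []) , (-1 ∷ -1 ∷ 0 ∷ -1 ∷ 1 ∷ 0 ∷ []))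
    ∷ ((0 ∷ 2 ∷ 6 ∷ 7 ∷ 8 ∷ 9 ∷ []) , (-2 ∷ 0 ∷ -1 ∷ -2 ∷ 0 ∷ 2 ∷ []))
    ∷ []
  coherenceData 6 =
    ((0 ∷ 1 ∷ 2 ∷ 3 ∷ 4 ∷ 8 ∷ 9 ∷ []) , (-4 ∷ 2 ∷ 4 ∷ -1 ∷ 4 ∷ 3 ∷ []))
    ∷ ((0 ∷ 1 ∷ 2 ∷ 3 ∷ 7 ∷ 8 ∷ 9 ∷ []) , (-2 ∷ 2 ∷ 0 ∷ 1 ∷ 1 ∷ 2 ∷ []))
    ∷ ((0 ∷ 1 ∷ 2 ∷ 6 ∷ 7 ∷ 8 ∷ 9 ∷ []) , (-2 ∷ 1 ∷ -1 ∷ -1 ∷ 0 ∷ 1 ∷ []))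
    ∷ ((0 ∷ 1 ∷ 5 ∷ 6 ∷ 7 ∷ 8 ∷ 9 ∷ []) , (-1 ∷ 2 ∷ 0 ∷ -2 ∷ 1 ∷ 2 ∷ []))
    ∷ []
  coherenceData _ = []

CoherenceCertificate : ∀ {ℓ} → Vec (Fin 10) (suc ℓ) × Point → Set
CoherenceCertificate (js , ω) =
  (∃[ a ] ∃[ b ] lookup c a * lookup ω b - lookup c b * lookup ω a ≢ 0ℚ) ×
  Coherence.CoherenceWitness V c ω (Vec.map pt js)

coherenceCertificate? : ∀ {ℓ} (cert : Vec (Fin 10) (suc ℓ) × Point) → Dec (CoherenceCertificate cert)
coherenceCertificate? (js , ω) =
  (Finₚ.any? λ a → Finₚ.any? λ b → ¬? (lookup c a * lookup ω b - lookup c b * lookup ω a ≟ 0ℚ)) ×-dec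
  Coherence.coherenceWitness? V c ω (Vec.map pt js)

Certified : ℕ → Set
Certified ℓ = Unique (walks ℓ 0) × List.map proj₁ (coherenceData ℓ) ≡ walks ℓ 0 × All CoherenceCertificate (coherenceData ℓ)

certified? : ∀ ℓ → Dec (Certified ℓ)
certified? ℓ = allPairs? (λ js ks → ¬? (Vecₚ.≡-dec Fin._≟_ js ks)) (walks ℓ 0) ×-dec
  Listₚ.≡-dec (Vecₚ.≡-dec Fin._≟_) (List.map proj₁ (coherenceData ℓ)) (walks ℓ 0) ×-dec
  All.all? coherenceCertificate? (coherenceData ℓ)

opaque
  unfolding vertices outArcs coherenceData
  -- No walk is longer than 6, so from length 7 on everything is empty.
  certified : ∀ ℓ → Certified ℓ
  certified 0 = from-yes (certified? 0)
  certified 1 = from-yes (certified? 1)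
  certified 2 = from-yes (certified? 2)
  certified 3 = from-yes (certified? 3)
  certified 4 = from-yes (certified? 4)
  certified 5 = from-yes (certified? 5)
  certified 6 = from-yes (certified? 6)
  certified (suc (suc (suc (suc (suc (suc (suc _))))))) = [] , refl , []

paths-unique : ∀ ℓ → Unique (paths ℓ)
paths-unique ℓ = Uniqueₚ.map⁺ (map-injective pt-injective) (proj₁ (certified ℓ))

listed⇒coherent : ∀ {ℓ p} → p ∈ paths ℓ → CoherentMonotonePath V c ℓ p
listed⇒coherent {ℓ} p∈ with ∈-map⁻ (Vec.map pt) p∈
... | js , js∈ , refl with certified ℓ
...   | _ , covered , certificates with ∈-map⁻ proj₁ (subst (js ∈_) (sym covered) js∈)
...     | (_ , ω) , cert∈ , refl with All.lookup certificates cert∈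
...       | (a , b , minor≢0) , witness =
  Coherence.coherent V c ω (Vec.map pt js) (walk-monotone js∈) (independent-of-minor c ω a b minor≢0) witness

N : ℕ → ℕ
N ℓ = List.length (paths ℓ)

count-monotone : ∀ ℓ → HasCount (Vec Point (suc ℓ)) (MonotonePath V c ℓ) (N ℓ)
count-monotone ℓ = paths ℓ , refl , paths-unique ℓ , λ _ → mk⇔ (proj₁ ∘ listed⇒coherent) monotone⇒listed

count-coherent : ∀ ℓ → HasCount (Vec Point (suc ℓ)) (CoherentMonotonePath V c ℓ) (N ℓ)
count-coherent ℓ = paths ℓ , refl , paths-unique ℓ , λ _ → mk⇔ listed⇒coherent (monotone⇒listed ∘ proj₁)

opaque
  unfolding outArcs
  counts-dip : N 2 ℕ.< N 1 × N 2 ℕ.< N 3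
  counts-dip = from-yes ((N 2 ℕ.<? N 1) ×-dec (N 2 ℕ.<? N 3))

theorem4p11 : ∃[ V ] ∃[ c ] (GenPermutahedron V × HasDimension V 5 × GenericDirection V c ×
                  ∃[ N ] ∃[ Ncoh ]
                    ((∀ ℓ → HasCount (Vec Point (suc ℓ)) (MonotonePath V c ℓ) (N ℓ)) ×
                     (∀ ℓ → HasCount (Vec Point (suc ℓ)) (CoherentMonotonePath V c ℓ) (Ncoh ℓ)) ×
                     ¬ Unimodal N × ¬ Unimodal Ncoh))
theorem4p11 =
  V , c , generalized-permutahedron , dimension , ((pt 0 , bottom) , (pt 9 , top)) ,
  N , N , count-monotone , count-coherent , not-unimodal , not-unimodal
  where
  not-unimodal : ¬ Unimodal N
  not-unimodal = valley⇒¬unimodal N 1 (proj₁ counts-dip) (proj₂ counts-dip)
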